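{- Let $\lambda$ be a partition with $d$ distinct part sizes and parameters $(h_1,\dots,h_d)$, $(v_1,\dots,v_d)$. Define $p^{\mathrm{col}}_{r,s}(q,t)=p_{r,s}(q^{ -1},t^{ -1})$ and $\overline{p}^{\mathrm{col}}_{r,s}(q,t)=\overline{p}_{r,s}(q^{ -1},t^{ -1})$. Then $$p^{\mathrm{col}}_{r,s}(q,t)=\begin{cases}q^{h_{s+1,d}}\alpha_s&r=0,\\ \tau^{\mathrm{col}}_{r,s}\dfrac{\alpha_s\beta_r}{\gamma'_{r,s}}&r>0,\end{cases}\qquad \overline{p}^{\mathrm{col}}_{r,s}(q,t)=\begin{cases}q^{h_{s+1,d}}\overline{\alpha}_s&r=0,\\ \tau^{\mathrm{col}}_{r,s}\dfrac{\overline{\alpha}_s\overline{\beta}_r}{\gamma'_{r,s}}&r>0,\end{cases}$$ where $\alpha_s,\overline{\alpha}_s,\beta_r,\overline{\beta}_r,\gamma'_{r,s}$ are evaluated at $(q,t)$ and $$\tau^{\mathrm{col}}_{r,s}=\begin{cases}q^{ -1+h_{r,s}}\,t^{1+2v_{r+1,s}}&0<r\le s,\\ q^{h_{s+1,r-1}}&r>s.\end{cases}$$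
   Context: Partitions are identified with their Young diagrams in French convention: $\lambda$ is the set of cells $(x,y)\in\mathbb{Z}_{>0}^2$ with $x\le\lambda_y$; $\lambda'$ is the conjugate. For $c=(x,y)\in\lambda$: $a_\lambda(c)=\lambda_y-x$, $\ell_\lambda(c)=\lambda'_x-y$; $n(\lambda)=\sum_c\ell_\lambda(c)$, $n'(\lambda)=\sum_c a_\lambda(c)$; $n(\rho/\kappa)=n(\rho)-n(\kappa)$, $n'(\rho/\kappa)=n'(\rho)-n'(\kappa)$. Parameters: if $\lambda$ has distinct part sizes $u_1>\dots>u_d>0$, $v_i$ is the multiplicity of $u_i$ and $h_i=u_i-u_{i+1}$ ($u_{d+1}=0$); $h_{i,j}=h_i+\dots+h_j$, $v_{i,j}=v_i+\dots+v_j$ for $i\le j$, and $0$ for $i>j$. For $s\in\{0,\dots,d\}$, $\lambda^{(+s)}$ is $\lambda$ with a cell added in row $v_{1,s}+1$; $\lambda^{(-0)}=\lambda$ and for $r\ge1$, $\lambda^{(-r)}$ is $\lambda$ with a cell removed from row $v_{1,r}$. For $\kappa\subseteq\rho$ with $\rho/\kappa$ one cell, $\mathcal{R}_{\rho/\kappa}$ (resp. $\mathcal{C}_{\rho/\kappa}$) is the set of cells of $\kappa$ in the same row (resp. column) as $\rho/\kappa$. With $[i,j]=1-q^it^j$ and $[i,j]^+=[i+1,j-1]$, $[i,j]^-=[i-1,j+1]$: $$\alpha_{\rho/\kappa}=\prod_{c\in\mathcal{R}_{\rho/\kappa}}\frac{[a_\kappa(c),\ell_\kappa(c)+1]}{[a_\rho(c),\ell_\rho(c)+1]}\prod_{c\in\mathcal{C}_{\rho/\kappa}}\frac{[a_\kappa(c)+1,\ell_\kappa(c)]}{[a_\rho(c)+1,\ell_\rho(c)]},\quad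 \overline{\alpha}_{\rho/\kappa}=\prod_{c\in\mathcal{R}_{\rho/\kappa}}\frac{[a_\kappa(c)+1,\ell_\kappa(c)]}{[a_\rho(c)+1,\ell_\rho(c)]}\prod_{c\in\mathcal{C}_{\rho/\kappa}}\frac{[a_\kappa(c),\ell_\kappa(c)+1]}{[a_\rho(c),\ell_\rho(c)+1]},$$ $\beta_{\rho/\kappa}=1/\alpha_{\rho/\kappa}$, $\overline{\beta}_{\rho/\kappa}=1/\overline{\alpha}_{\rho/\kappa}$; $\alpha_s=\alpha_{\lambda^{(+s)}/\lambda}$, $\overline{\alpha}_s=\overline{\alpha}_{\lambda^{(+s)}/\lambda}$, $\beta_r=\beta_{\lambda/\lambda^{(-r)}}$, $\overline{\beta}_r=\overline{\beta}_{\lambda/\lambda^{(-r)}}$ ($r\ge1$). Also $$\gamma'_{r,s}=\begin{cases}\dfrac{[h_{r,s},v_{r+1,s}]\,[h_{r,s},v_{r+1,s}]^- }{[0,1][1,0]}&0<r\le s,\\[2mm] \dfrac{[h_{s+1,r-1},v_{s+1,r}]\,[h_{s+1,r-1},v_{s+1,r}]^+}{[0,1][1,0]}&r>s.\end{cases}$$ For $\mu\subseteq\lambda\subseteq\nu$ with one-cell differences, $N=n(\nu/\lambda)-n(\lambda/\mu)$, $M=n'(\lambda/\mu)-n'(\nu/\lambda)$, $\gamma_{\nu/\lambda/\mu}=\frac{(1-q^Mt^N)(1-q^{M+1}t^{N-1})}{(1-q)(1-t)}$. Define $\mathcal{P}_\lambda(\lambda\to\nu)=t^{n(\nu/\lambda)}\alpha_{\nu/\lambda}$,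 $\overline{\mathcal{P}}_\lambda(\lambda\leftarrow\nu)=t^{n(\nu/\lambda)}\overline{\alpha}_{\nu/\lambda}$, and for $\mu\ne\lambda$, $\mathcal{P}_\lambda(\mu\to\nu)=t^{N-1}\alpha_{\nu/\lambda}\beta_{\lambda/\mu}/\gamma_{\nu/\lambda/\mu}$, $\overline{\mathcal{P}}_\lambda(\mu\leftarrow\nu)=t^{N-1}\overline{\alpha}_{\nu/\lambda}\overline{\beta}_{\lambda/\mu}/\gamma_{\nu/\lambda/\mu}$. Finally $p_{r,s}(q,t)=\mathcal{P}_\lambda(\lambda^{(-r)}\to\lambda^{(+s)})$ and $\overline{p}_{r,s}(q,t)=\overline{\mathcal{P}}_\lambda(\lambda^{(-r)}\leftarrow\lambda^{(+s)})$, for $r,s\in\{0,\dots,d\}$. -}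

module Defs where

open import Data.Nat as ℕ using (ℕ; zero; suc; _∸_; _≤?_)
open import Data.Integer as ℤ using (ℤ; +_; -[1+_])
open import Data.Rational as ℚ using (ℚ; 0ℚ; 1ℚ; 1/_; _*_; _-_)
open import Data.Rational.Properties as ℚP using ()
open import Data.List using (List; []; _∷_; length; map; filter; concat; foldr; upTo; deduplicate)
open import Data.Nat.ListAction using (sum)
open import Data.List.Relation.Unary.All using (All)
open import Data.List.Relation.Unary.Linked using (Linked)
open import Data.Product using (_×_; _,_; proj₁; proj₂; Σ)
open import Relation.Nullary using (¬_; yes; no)
open import Relation.Binary.PropositionalEquality using (_≡_; _≢_)

-- Partitions: weakly decreasing lists of positive naturals
-- (λ_1 ≥ λ_2 ≥ … > 0); row y (1-indexed) has λ_y cells.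

IsPartition : List ℕ → Set
IsPartition l = All (λ x → 1 ℕ.≤ x) l × Linked ℕ._≥_ l

-- 1-indexed lookup with default 0 (so λ_y = 0 for y > ℓ(λ), u_{d+1} = 0)
at : List ℕ → ℕ → ℕ
at []      _             = 0
at (x ∷ l) zero          = 0
at (x ∷ l) (suc zero)    = x
at (x ∷ l) (suc (suc k)) = at l (suc k)

fromTo : ℕ → ℕ → List ℕ
fromTo i j = map (i ℕ.+_) (upTo (suc j ∸ i))

row : List ℕ → ℕ → ℕ
row = at

conj : List ℕ → ℕ → ℕ
conj l x = length (filter (x ≤?_) l)

Cell : Set
Cell = ℕ × ℕ                   -- (x , y) : column x, row y

cells : List ℕ → List Cell
cells l = concat (map (λ y → map (λ x → (x , y)) (fromTo 1 (row l y))) (fromTo 1 (length l)))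

arm : List ℕ → Cell → ℕ
arm l (x , y) = row l y ∸ x

leg : List ℕ → Cell → ℕ
leg l (x , y) = conj l x ∸ y

nn : List ℕ → ℕ
nn l = sum (map (leg l) (cells l))

nn' : List ℕ → ℕ
nn' l = sum (map (arm l) (cells l))

nDiff : List ℕ → List ℕ → ℤ
nDiff ρ κ = + nn ρ ℤ.- + nn κ

n'Diff : List ℕ → List ℕ → ℤ
n'Diff ρ κ = + nn' ρ ℤ.- + nn' κ

-- add a cell at the end of row y (1-indexed); y = ℓ(λ)+1 starts a new row
addCell : List ℕ → ℕ → List ℕ
addCell []      _             = 1 ∷ []
addCell (x ∷ l) zero          = x ∷ l
addCell (x ∷ l) (suc zero)    = suc x ∷ l
addCell (x ∷ l) (suc (suc k)) = x ∷ addCell l (suc k)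

-- remove the last cell of row y (1-indexed); an emptied row is dropped
decAt : List ℕ → ℕ → List ℕ
decAt []      _             = []
decAt (x ∷ l) zero          = x ∷ l
decAt (x ∷ l) (suc zero)    = x ∸ 1 ∷ l
decAt (x ∷ l) (suc (suc k)) = x ∷ decAt l (suc k)

removeCell : List ℕ → ℕ → List ℕ
removeCell l y = filter (1 ≤?_) (decAt l y)

-- Parameters of λ: distinct part sizes u_1 > … > u_d, multiplicities v_i,
-- h_i = u_i - u_{i+1}; all 1-indexed, default 0 out of range.

us : List ℕ → List ℕ
us l = deduplicate ℕ._≟_ l

dd : List ℕ → ℕ
dd l = length (us l)

uu : List ℕ → ℕ → ℕ
uu l i = at (us l) i

vv : List ℕ → ℕ → ℕ
vv l i = length (filter (ℕ._≟ uu l i) l)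

hh : List ℕ → ℕ → ℕ
hh l i = uu l i ∸ uu l (suc i)

hs : List ℕ → ℕ → ℕ → ℕ
hs l i j = sum (map (hh l) (fromTo i j))

vs : List ℕ → ℕ → ℕ → ℕ
vs l i j = sum (map (vv l) (fromTo i j))

plusS : List ℕ → ℕ → List ℕ
plusS l s = addCell l (suc (vs l 1 s))

minusR : List ℕ → ℕ → List ℕ
minusR l zero    = l
minusR l (suc r) = removeCell l (vs l 1 (suc r))

-- Rational arithmetic. Total inverse (inv 0 = 0, never used at 0 under
-- the genericity hypothesis) and integer powers.

inv : ℚ → ℚ
inv p with p ℚP.≟ 0ℚ
... | yes _ = 0ℚ
... | no ne = 1/_ p {{ℚ.≢-nonZero ne}}

_÷'_ : ℚ → ℚ → ℚ
a ÷' b = a * inv b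

pow : ℚ → ℕ → ℚ
pow p zero    = 1ℚ
pow p (suc n) = p * pow p n

zpow : ℚ → ℤ → ℚ
zpow p (+ n)      = pow p n
zpow p -[1+ n ]   = inv (pow p (suc n))

prod : List ℚ → ℚ
prod = foldr _*_ 1ℚ

br : ℚ → ℚ → ℤ → ℤ → ℚ
br q t i j = 1ℚ - zpow q i * zpow t j

Generic : ℚ → ℚ → Set
Generic q t = q ≢ 0ℚ × t ≢ 0ℚ ×
  ((i j : ℤ) → ¬ (i ≡ + 0 × j ≡ + 0) → zpow q i * zpow t j ≢ 1ℚ)

-- α_{ρ/κ} and ᾱ_{ρ/κ}, where ρ = κ with one cell added at the end of row y0.

private
  ι : ℕ → ℤ
  ι n = + n

Rset : List ℕ → ℕ → List Cell
Rset κ y0 = filter (λ c → proj₂ c ℕ.≟ y0) (cells κ)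

Cset : List ℕ → ℕ → List Cell
Cset κ y0 = filter (λ c → proj₁ c ℕ.≟ suc (row κ y0)) (cells κ)

alphaAdd : ℚ → ℚ → List ℕ → ℕ → ℚ
alphaAdd q t κ y0 =
  prod (map (λ c → br q t (ι (arm κ c)) (ι (suc (leg κ c)))
                 ÷' br q t (ι (arm ρ c)) (ι (suc (leg ρ c)))) (Rset κ y0))
  * prod (map (λ c → br q t (ι (suc (arm κ c))) (ι (leg κ c))
                 ÷' br q t (ι (suc (arm ρ c))) (ι (leg ρ c))) (Cset κ y0))
  where ρ = addCell κ y0

alphaBarAdd : ℚ → ℚ → List ℕ → ℕ → ℚ
alphaBarAdd q t κ y0 =
  prod (map (λ c → br q t (ι (suc (arm κ c))) (ι (leg κ c))
                 ÷' br q t (ι (suc (arm ρ c))) (ι (leg ρ c))) (Rset κ y0))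
  * prod (map (λ c → br q t (ι (arm κ c)) (ι (suc (leg κ c)))
                 ÷' br q t (ι (arm ρ c)) (ι (suc (leg ρ c)))) (Cset κ y0))
  where ρ = addCell κ y0

alphaS : ℚ → ℚ → List ℕ → ℕ → ℚ
alphaS q t l s = alphaAdd q t l (suc (vs l 1 s))

alphaBarS : ℚ → ℚ → List ℕ → ℕ → ℚ
alphaBarS q t l s = alphaBarAdd q t l (suc (vs l 1 s))

-- β_r = 1/α_{λ/λ^{(-r)}} (r ≥ 1), β̄_r; λ = λ^{(-r)} plus a cell in row v_{1,r}
betaR : ℚ → ℚ → List ℕ → ℕ → ℚ
betaR q t l r = inv (alphaAdd q t (minusR l r) (vs l 1 r))

betaBarR : ℚ → ℚ → List ℕ → ℕ → ℚ
betaBarR q t l r = inv (alphaBarAdd q t (minusR l r) (vs l 1 r))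

gammaNLM : ℚ → ℚ → List ℕ → List ℕ → List ℕ → ℚ
gammaNLM q t ν l μ =
  (br q t M N * br q t (M ℤ.+ + 1) (N ℤ.- + 1)) ÷' (br q t (+ 1) (+ 0) * br q t (+ 0) (+ 1))
  where
    N = nDiff ν l ℤ.- nDiff l μ
    M = n'Diff l μ ℤ.- n'Diff ν l

gammaP : ℚ → ℚ → List ℕ → ℕ → ℕ → ℚ
gammaP q t l r s with r ℕ.≤? s
... | yes _ = (br q t H V * br q t (H ℤ.- + 1) (V ℤ.+ + 1)) ÷' (br q t (+ 0) (+ 1) * br q t (+ 1) (+ 0))
  where H = + hs l r s
        V = + vs l (suc r) s
... | no _  = (br q t H V * br q t (H ℤ.+ + 1) (V ℤ.- + 1)) ÷' (br q t (+ 0) (+ 1) * br q t (+ 1) (+ 0))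
  where H = + hs l (suc s) (r ∸ 1)
        V = + vs l (suc s) r

pRS : ℚ → ℚ → List ℕ → ℕ → ℕ → ℚ
pRS q t l zero s = zpow t (nDiff (plusS l s) l) * alphaS q t l s
pRS q t l (suc r) s =
  zpow t (N ℤ.- + 1) * alphaS q t l s * betaR q t l (suc r)
    ÷' gammaNLM q t (plusS l s) l (minusR l (suc r))
  where N = nDiff (plusS l s) l ℤ.- nDiff l (minusR l (suc r))

pBarRS : ℚ → ℚ → List ℕ → ℕ → ℕ → ℚ
pBarRS q t l zero s = zpow t (nDiff (plusS l s) l) * alphaBarS q t l s
pBarRS q t l (suc r) s =
  zpow t (N ℤ.- + 1) * alphaBarS q t l s * betaBarR q t l (suc r)
    ÷' gammaNLM q t (plusS l s) l (minusR l (suc r))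
  where N = nDiff (plusS l s) l ℤ.- nDiff l (minusR l (suc r))

pCol : ℚ → ℚ → List ℕ → ℕ → ℕ → ℚ
pCol q t l r s = pRS (inv q) (inv t) l r s

pBarCol : ℚ → ℚ → List ℕ → ℕ → ℕ → ℚ
pBarCol q t l r s = pBarRS (inv q) (inv t) l r s

tauCol : ℚ → ℚ → List ℕ → ℕ → ℕ → ℚ
tauCol q t l r s with r ℕ.≤? s
... | yes _ = zpow q (-[1+ 0 ] ℤ.+ + hs l r s) * zpow t (+ (1 ℕ.+ 2 ℕ.* vs l (suc r) s))
... | no _  = zpow q (+ hs l (suc s) (r ∸ 1))

pColRHS : ℚ → ℚ → List ℕ → ℕ → ℕ → ℚ
pColRHS q t l zero s    = zpow q (+ hs l (suc s) (dd l)) * alphaS q t l s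
pColRHS q t l (suc r) s =
  tauCol q t l (suc r) s * (alphaS q t l s * betaR q t l (suc r)) ÷' gammaP q t l (suc r) s

pBarColRHS : ℚ → ℚ → List ℕ → ℕ → ℕ → ℚ
pBarColRHS q t l zero s    = zpow q (+ hs l (suc s) (dd l)) * alphaBarS q t l s
pBarColRHS q t l (suc r) s =
  tauCol q t l (suc r) s * (alphaBarS q t l s * betaBarR q t l (suc r)) ÷' gammaP q t l (suc r) s

-- Inverting q and t turns a bracket [a, b] with a, b ≥ 0 into -q^-a t^-b [a, b].
-- A cell of κ in the row of the new cell of ρ changes (a, ℓ) to (a + 1, ℓ), one in its
-- column changes it to (a, ℓ + 1); so each factor of α_{ρ/κ} or ᾱ_{ρ/κ} picks up q,
-- resp. t, and inversion multiplies both by q^(κ_y) t^(y-1) when the new cell is at the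
-- end of row y. For λ^(+s)/λ this is q^(u_{s+1}) t^(v_{1,s}); for λ/λ^(-r) it is
-- q^(u_r - 1) t^(v_{1,r} - 1). The same numbers are n'(ν/λ), n(ν/λ), n'(λ/μ), n(λ/μ),
-- so the exponents of γ_{ν/λ/μ} are (h_{r,s} - 1, v_{r+1,s} + 1) when r ≤ s and
-- (-1 - h_{s+1,r-1}, 1 - v_{s+1,r}) when r > s; inverting gives γ'_{r,s} up to a monomial,
-- and collecting all monomials yields τ^col_{r,s}.

module Submission where

module TotalInverse where
  open import Defs
  open import Data.Nat as ℕ using (ℕ; zero; suc)
  open import Data.Integer as ℤ using (ℤ; +_; -[1+_])
  open import Data.Rational as ℚ using (ℚ; 0ℚ; 1ℚ; _*_; -_; _-_)
  import Data.Rational.Properties as ℚP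
  open import Data.Rational.Solver using (module +-*-Solver)
  open import Data.Empty using (⊥-elim)
  open import Relation.Nullary using (yes; no; Dec)
  open import Relation.Binary.PropositionalEquality

  open +-*-Solver

  inv-inverseʳ : ∀ p → p ≢ 0ℚ → p * inv p ≡ 1ℚ
  inv-inverseʳ p p≢0 with p ℚP.≟ 0ℚ
  ... | yes p≡0 = ⊥-elim (p≢0 p≡0)
  ... | no  p≢0′ = ℚP.*-inverseʳ p {{ℚ.≢-nonZero p≢0′}}

  inv-unique : ∀ p x → p ≢ 0ℚ → x * p ≡ 1ℚ → x ≡ inv p
  inv-unique p x p≢0 xp≡1 = begin
    x                ≡⟨ sym (ℚP.*-identityʳ x) ⟩
    x * 1ℚ           ≡⟨ cong (x *_) (sym (inv-inverseʳ p p≢0)) ⟩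
    x * (p * inv p)  ≡⟨ sym (ℚP.*-assoc x p (inv p)) ⟩
    (x * p) * inv p  ≡⟨ cong (_* inv p) xp≡1 ⟩
    1ℚ * inv p       ≡⟨ ℚP.*-identityˡ (inv p) ⟩
    inv p            ∎
    where open ≡-Reasoning

  *-≢0 : ∀ a b → a ≢ 0ℚ → b ≢ 0ℚ → a * b ≢ 0ℚ
  *-≢0 a b a≢0 b≢0 ab≡0 = b≢0 (begin
    b                ≡⟨ sym (ℚP.*-identityˡ b) ⟩
    1ℚ * b           ≡⟨ cong (_* b) (sym (trans (ℚP.*-comm (inv a) a) (inv-inverseʳ a a≢0))) ⟩
    (inv a * a) * b  ≡⟨ ℚP.*-assoc (inv a) a b ⟩
    inv a * (a * b)  ≡⟨ cong (inv a *_) ab≡0 ⟩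
    inv a * 0ℚ       ≡⟨ ℚP.*-zeroʳ (inv a) ⟩
    0ℚ               ∎)
    where open ≡-Reasoning

  inv-≢0 : ∀ p → p ≢ 0ℚ → inv p ≢ 0ℚ
  inv-≢0 p p≢0 inv≡0 = ℚP.1≢0 (begin
    1ℚ           ≡⟨ sym (inv-inverseʳ p p≢0) ⟩
    p * inv p    ≡⟨ cong (p *_) inv≡0 ⟩
    p * 0ℚ       ≡⟨ ℚP.*-zeroʳ p ⟩
    0ℚ           ∎)
    where open ≡-Reasoning

  -- The three laws below hold at 0 as well, because inv 0ℚ = 0ℚ.
  inv-distrib-* : ∀ a b → inv (a * b) ≡ inv a * inv b
  inv-distrib-* a b = by-cases (a ℚP.≟ 0ℚ) (b ℚP.≟ 0ℚ)
    where
    open ≡-Reasoning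
    by-cases : Dec (a ≡ 0ℚ) → Dec (b ≡ 0ℚ) → inv (a * b) ≡ inv a * inv b
    by-cases (yes refl) _ = trans (cong inv (ℚP.*-zeroˡ b)) (sym (ℚP.*-zeroˡ (inv b)))
    by-cases (no _) (yes refl) = trans (cong inv (ℚP.*-zeroʳ a)) (sym (ℚP.*-zeroʳ (inv a)))
    by-cases (no a≢0) (no b≢0) = sym (inv-unique (a * b) (inv a * inv b) (*-≢0 a b a≢0 b≢0) (begin
      (inv a * inv b) * (a * b)  ≡⟨ solve 4 (λ a b x y → (x :* y) :* (a :* b) := (a :* x) :* (b :* y)) refl a b (inv a) (inv b) ⟩
      (a * inv a) * (b * inv b)  ≡⟨ cong₂ _*_ (inv-inverseʳ a a≢0) (inv-inverseʳ b b≢0) ⟩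
      1ℚ                         ∎))

  inv-involutive : ∀ a → inv (inv a) ≡ a
  inv-involutive a = by-cases (a ℚP.≟ 0ℚ)
    where
    by-cases : Dec (a ≡ 0ℚ) → inv (inv a) ≡ a
    by-cases (yes refl) = refl
    by-cases (no a≢0) = sym (inv-unique (inv a) a (inv-≢0 a a≢0) (inv-inverseʳ a a≢0))

  inv-neg : ∀ a → inv (- a) ≡ - inv a
  inv-neg a = by-cases (a ℚP.≟ 0ℚ)
    where
    by-cases : Dec (a ≡ 0ℚ) → inv (- a) ≡ - inv a
    by-cases (yes refl) = refl
    by-cases (no a≢0) = sym (inv-unique (- a) (- inv a) (λ -a≡0 → a≢0 (ℚP.neg-injective -a≡0))
      (trans (solve 2 (λ a x → (:- x) :* (:- a) := a :* x) refl a (inv a)) (inv-inverseʳ a a≢0)))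

  *-inv-cancel : ∀ a b c → b ≢ 0ℚ → a ≡ c * b → a * inv b ≡ c
  *-inv-cancel a b c b≢0 refl = begin
    (c * b) * inv b  ≡⟨ ℚP.*-assoc c b (inv b) ⟩
    c * (b * inv b)  ≡⟨ cong (c *_) (inv-inverseʳ b b≢0) ⟩
    c * 1ℚ           ≡⟨ ℚP.*-identityʳ c ⟩
    c                ∎
    where open ≡-Reasoning

  ÷'-scale : ∀ k k′ x y → (k * x) ÷' (k′ * y) ≡ (k * inv k′) * (x ÷' y)
  ÷'-scale k k′ x y = begin
    (k * x) * inv (k′ * y)        ≡⟨ cong ((k * x) *_) (inv-distrib-* k′ y) ⟩
    (k * x) * (inv k′ * inv y)    ≡⟨ solve 4 (λ k x k′ y → (k :* x) :* (k′ :* y) := (k :* k′) :* (x :* y)) refl k x (inv k′) (inv y) ⟩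
    (k * inv k′) * (x * inv y)    ∎
    where open ≡-Reasoning

  pow-≢0 : ∀ a n → a ≢ 0ℚ → pow a n ≢ 0ℚ
  pow-≢0 a zero    a≢0 ()
  pow-≢0 a (suc n) a≢0 = *-≢0 a (pow a n) a≢0 (pow-≢0 a n a≢0)

  pow-+ : ∀ a m n → pow a (m ℕ.+ n) ≡ pow a m * pow a n
  pow-+ a zero    n = sym (ℚP.*-identityˡ (pow a n))
  pow-+ a (suc m) n = trans (cong (a *_) (pow-+ a m n)) (sym (ℚP.*-assoc a (pow a m) (pow a n)))

  pow-inv : ∀ a n → pow (inv a) n ≡ inv (pow a n)
  pow-inv a zero    = refl
  pow-inv a (suc n) = trans (cong (inv a *_) (pow-inv a n)) (sym (inv-distrib-* a (pow a n)))

  zpow-inv-neg : ∀ a i → zpow (inv a) (ℤ.- i) ≡ zpow a i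
  zpow-inv-neg a (+ zero)  = refl
  zpow-inv-neg a (+ suc n) = trans (cong inv (pow-inv a (suc n))) (inv-involutive (pow a (suc n)))
  zpow-inv-neg a -[1+ n ]  = pow-inv a (suc n)

  ÷'-rescale : ∀ d a b c x y z → d * (a * x) * (inv (b * y) ÷' (c * z)) ≡ (d * a * inv b * inv c) * ((x * inv y) ÷' z)
  ÷'-rescale d a b c x y z = begin
    d * (a * x) * (inv (b * y) * inv (c * z))
      ≡⟨ cong₂ (λ u v → d * (a * x) * (u * v)) (inv-distrib-* b y) (inv-distrib-* c z) ⟩
    d * (a * x) * ((inv b * inv y) * (inv c * inv z))
      ≡⟨ solve 7 (λ d a x b′ y′ c′ z′ → d :* (a :* x) :* ((b′ :* y′) :* (c′ :* z′)) := (d :* a :* b′ :* c′) :* ((x :* y′) :* z′))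
           refl d a x (inv b) (inv y) (inv c) (inv z) ⟩
    (d * a * inv b * inv c) * ((x * inv y) * inv z) ∎
    where open ≡-Reasoning

  neg-*-neg : ∀ x₁ x₂ X₁ X₂ → (- x₁ * X₁) * (- x₂ * X₂) ≡ (x₁ * x₂) * (X₂ * X₁)
  neg-*-neg = solve 4 (λ x₁ x₂ X₁ X₂ → (:- x₁ :* X₁) :* (:- x₂ :* X₂) := (x₁ :* x₂) :* (X₂ :* X₁)) refl

module YoungDiagrams where
  open import Defs
  open import Data.Nat as ℕ using (ℕ; zero; suc; _+_; _∸_; _≤_; _<_; z≤n; s≤s; _≤?_; _≟_)
  import Data.Nat.Properties as NP
  open import Data.List using (List; []; _∷_; length; map; filter; concat; upTo; _++_; applyUpTo)
  import Data.List.Properties as LP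
  open import Data.Nat.ListAction using (sum)
  open import Data.Nat.ListAction.Properties using (sum-++)
  open import Data.List.Relation.Unary.All as All using (All; []; _∷_)
  import Data.List.Relation.Unary.All.Properties as AllP
  open import Data.List.Relation.Unary.Linked using (_∷_)
  open import Data.Product using (_×_; _,_; proj₁; proj₂)
  open import Data.Sum using (_⊎_; inj₁; inj₂)
  open import Relation.Binary using (tri<; tri≈; tri>)
  open import Data.Unit using (⊤; tt)
  open import Data.Empty using (⊥; ⊥-elim)
  open import Data.Bool using (true; false)
  open import Relation.Nullary using (¬_; yes; no; does)
  open import Relation.Unary using (Pred; Decidable)
  open import Relation.Binary.PropositionalEquality
  open import Function using (_∘_; id)
  open import Level using (0ℓ)
  import Data.Nat.Solver as ℕSolver
  open ℕSolver.+-*-Solver using (solve; _:+_; _:=_; con)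

  -- Ranges and sums over them

  range : ℕ → ℕ → List ℕ
  range i n = map (i +_) (upTo n)

  range-suc : ∀ i n → range i (suc n) ≡ i ∷ range (suc i) n
  range-suc i n = cong₂ _∷_ (NP.+-identityʳ i) (begin
    map (i +_) (applyUpTo suc n) ≡⟨ LP.map-applyUpTo suc (i +_) n ⟩
    applyUpTo (λ k → i + suc k) n ≡⟨ sym (LP.map-applyUpTo id (λ k → i + suc k) n) ⟩
    map (λ k → i + suc k) (upTo n) ≡⟨ LP.map-cong (λ k → NP.+-suc i k) (upTo n) ⟩
    map (suc i +_) (upTo n) ∎)
    where open ≡-Reasoning

  range-+ : ∀ i m n → range i (m + n) ≡ range i m ++ range (i + m) n
  range-+ i zero n = cong (λ z → range z n) (sym (NP.+-identityʳ i))
  range-+ i (suc m) n = begin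
    range i (suc (m + n)) ≡⟨ range-suc i (m + n) ⟩
    i ∷ range (suc i) (m + n) ≡⟨ cong (i ∷_) (range-+ (suc i) m n) ⟩
    i ∷ (range (suc i) m ++ range (suc i + m) n) ≡⟨ cong (λ z → i ∷ (range (suc i) m ++ range z n)) (sym (NP.+-suc i m)) ⟩
    (i ∷ range (suc i) m) ++ range (i + suc m) n ≡⟨ cong (_++ range (i + suc m) n) (sym (range-suc i m)) ⟩
    range i (suc m) ++ range (i + suc m) n ∎
    where open ≡-Reasoning

  range-snoc : ∀ i n → range i (suc n) ≡ range i n ++ (i + n ∷ [])
  range-snoc i n = trans (cong (range i) (NP.+-comm 1 n)) (trans (range-+ i n 1) (cong (λ z → range i n ++ (z ∷ [])) (NP.+-identityʳ (i + n))))

  range-bounds : ∀ i n → All (λ k → i ≤ k × k < i + n) (range i n)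
  range-bounds i zero = []
  range-bounds i (suc n) rewrite range-suc i n =
    (NP.≤-refl , subst (i <_) (sym (NP.+-suc i n)) (s≤s (NP.m≤m+n i n)))
    ∷ All.map (λ {k} (a , b) → NP.≤-trans (NP.n≤1+n i) a , subst (k <_) (sym (NP.+-suc i n)) b) (range-bounds (suc i) n)

  length-range : ∀ i n → length (range i n) ≡ n
  length-range i n = trans (LP.length-map (i +_) (upTo n)) (LP.length-applyUpTo id n)

  sum-map-cong : ∀ {A : Set} {f g : A → ℕ} {xs} → All (λ x → f x ≡ g x) xs → sum (map f xs) ≡ sum (map g xs)
  sum-map-cong [] = refl
  sum-map-cong (e ∷ es) = cong₂ _+_ e (sum-map-cong es)

  sum-map-+ : ∀ {A : Set} (f g : A → ℕ) xs → sum (map (λ x → f x + g x) xs) ≡ sum (map f xs) + sum (map g xs)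
  sum-map-+ f g [] = refl
  sum-map-+ f g (x ∷ xs) rewrite sum-map-+ f g xs =
    solve 4 (λ a b c d → (a :+ b) :+ (c :+ d) := (a :+ c) :+ (b :+ d)) refl (f x) (g x) (sum (map f xs)) (sum (map g xs))

  sum-map-zero : ∀ {A : Set} (xs : List A) → sum (map (λ _ → 0) xs) ≡ 0
  sum-map-zero [] = refl
  sum-map-zero (x ∷ xs) = sum-map-zero xs

  sum-map-suc : ∀ {A : Set} (f : A → ℕ) xs → sum (map (λ x → suc (f x)) xs) ≡ length xs + sum (map f xs)
  sum-map-suc f [] = refl
  sum-map-suc f (x ∷ xs) rewrite sum-map-suc f xs =
    cong suc (solve 3 (λ a b c → a :+ (b :+ c) := b :+ (a :+ c)) refl (f x) (length xs) (sum (map f xs)))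

  sumRange : (ℕ → ℕ) → ℕ → ℕ → ℕ
  sumRange f i n = sum (map f (range i n))

  sumRange-+ : ∀ f i m n → sumRange f i (m + n) ≡ sumRange f i m + sumRange f (i + m) n
  sumRange-+ f i m n = trans (cong (λ z → sum (map f z)) (range-+ i m n))
    (trans (cong sum (LP.map-++ f (range i m) (range (i + m) n))) (sum-++ (map f (range i m)) _))

  sumRange-suc : ∀ f i n → sumRange f i (suc n) ≡ f i + sumRange f (suc i) n
  sumRange-suc f i n = cong (λ z → sum (map f z)) (range-suc i n)

  sumRange-snoc : ∀ f i n → sumRange f i (suc n) ≡ sumRange f i n + f (i + n)
  sumRange-snoc f i n = trans (cong (λ z → sum (map f z)) (range-snoc i n))
    (trans (cong sum (LP.map-++ f (range i n) (i + n ∷ [])))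
    (trans (sum-++ (map f (range i n)) (f (i + n) ∷ [])) (cong (sumRange f i n +_) (NP.+-identityʳ (f (i + n))))))

  sumRange-cong : ∀ {f g} i n → (∀ k → i ≤ k → f k ≡ g k) → sumRange f i n ≡ sumRange g i n
  sumRange-cong i n h = sum-map-cong (All.map (λ {k} p → h k (proj₁ p)) (range-bounds i n))

  sumRange-telescope : ∀ (g : ℕ → ℕ) i n → (∀ k → i ≤ k → g (suc k) ≤ g k) →
                       sumRange (λ k → g k ∸ g (suc k)) i n + g (i + n) ≡ g i
  sumRange-telescope g i zero h = cong g (NP.+-identityʳ i)
  sumRange-telescope g i (suc n) h = begin
    sumRange G i (suc n) + g (i + suc n) ≡⟨ cong₂ _+_ (sumRange-suc G i n) (cong g (NP.+-suc i n)) ⟩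
    (G i + sumRange G (suc i) n) + g (suc i + n) ≡⟨ NP.+-assoc (G i) _ _ ⟩
    G i + (sumRange G (suc i) n + g (suc i + n)) ≡⟨ cong (G i +_) (sumRange-telescope g (suc i) n (λ k p → h k (NP.≤-trans (NP.n≤1+n i) p))) ⟩
    G i + g (suc i) ≡⟨ NP.m∸n+n≡m (h i NP.≤-refl) ⟩
    g i ∎
    where open ≡-Reasoning
          G = λ k → g k ∸ g (suc k)

  filter-map-comm : ∀ {A B : Set} {P : Pred A 0ℓ} {Q : Pred B 0ℓ} (P? : Decidable P) (Q? : Decidable Q) (f : B → A) →
    (∀ x → does (P? (f x)) ≡ does (Q? x)) → ∀ xs → filter P? (map f xs) ≡ map f (filter Q? xs)
  filter-map-comm P? Q? f h [] = refl
  filter-map-comm P? Q? f h (x ∷ xs) with does (Q? x) | h x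
  ... | true | e rewrite e = cong (f x ∷_) (filter-map-comm P? Q? f h xs)
  ... | false | e rewrite e = filter-map-comm P? Q? f h xs

  -- Young diagrams

  Partition : List ℕ → Set
  Partition [] = ⊤
  Partition (x ∷ xs) = 1 ≤ x × at xs 1 ≤ x × Partition xs

  IsPartition⇒Partition : ∀ l → IsPartition l → Partition l
  IsPartition⇒Partition [] _ = tt
  IsPartition⇒Partition (x ∷ []) (px ∷ [] , _) = px , z≤n , tt
  IsPartition⇒Partition (x ∷ y ∷ l) (px ∷ pxs , (x≥y ∷ lk)) = px , x≥y , IsPartition⇒Partition (y ∷ l) (pxs , lk)

  Partition-tail : ∀ {a l} → Partition (a ∷ l) → Partition l
  Partition-tail (_ , _ , p) = p

  row≤head : ∀ l → Partition l → ∀ y → at l y ≤ at l 1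
  row≤head [] _ y = z≤n
  row≤head (x ∷ l) p zero = z≤n
  row≤head (x ∷ l) p (suc zero) = NP.≤-refl
  row≤head (x ∷ l) (_ , h , p) (suc (suc k)) = NP.≤-trans (row≤head l p (suc k)) h

  tail-row≤head : ∀ {a l} → Partition (a ∷ l) → ∀ y → at l y ≤ a
  tail-row≤head {a} {l} (_ , h , p) y = NP.≤-trans (row≤head l p y) h

  tail-All≤head : ∀ {a l} → Partition (a ∷ l) → All (_≤ a) l
  tail-All≤head {a} {[]} p = []
  tail-All≤head {a} {b ∷ l} (pa , h , p) = h ∷ All.map (λ x≤b → NP.≤-trans x≤b h) (tail-All≤head p)

  All-positive : ∀ l → Partition l → All (1 ≤_) l
  All-positive [] _ = []
  All-positive (x ∷ l) (px , _ , p) = px ∷ All-positive l p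

  Addable : List ℕ → ℕ → Set
  Addable κ zero = ⊥
  Addable κ (suc zero) = ⊤
  Addable [] (suc (suc k)) = ⊥
  Addable (a ∷ l) (suc (suc zero)) = at l 1 < a
  Addable (a ∷ l) (suc (suc (suc k))) = Addable l (suc (suc k))

  Removable : List ℕ → ℕ → Set
  Removable [] _ = ⊥
  Removable (a ∷ l) zero = ⊥
  Removable (a ∷ l) (suc zero) = at l 1 < a
  Removable (a ∷ l) (suc (suc k)) = Removable l (suc k)

  conj-∷ : ∀ b l x → conj (b ∷ l) x ≡ conj (b ∷ []) x + conj l x
  conj-∷ b l x with x ℕ.≤ᵇ b
  ... | true = refl
  ... | false = refl

  conj-[]-≤ : ∀ {b x} → x ≤ b → conj (b ∷ []) x ≡ 1
  conj-[]-≤ {b} {x} p with x ℕ.≤ᵇ b | NP.≤⇒≤ᵇ p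
  ... | true | _ = refl
  ... | false | ()

  conj-[]-≰ : ∀ {b x} → ¬ x ≤ b → conj (b ∷ []) x ≡ 0
  conj-[]-≰ {b} {x} np with x ℕ.≤ᵇ b | NP.≤ᵇ⇒≤ x b
  ... | true | f = ⊥-elim (np (f tt))
  ... | false | _ = refl

  conj-∷-≤ : ∀ {b l x} → x ≤ b → conj (b ∷ l) x ≡ suc (conj l x)
  conj-∷-≤ {b} {l} {x} p = trans (conj-∷ b l x) (cong (_+ conj l x) (conj-[]-≤ p))

  conj-∷-≰ : ∀ {b l x} → ¬ x ≤ b → conj (b ∷ l) x ≡ conj l x
  conj-∷-≰ {b} {l} {x} p = trans (conj-∷ b l x) (cong (_+ conj l x) (conj-[]-≰ p))

  conj-beyond : ∀ l x → All (_< x) l → conj l x ≡ 0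
  conj-beyond [] x _ = refl
  conj-beyond (b ∷ l) x (p ∷ ps) = trans (conj-∷-≰ (λ q → NP.<-irrefl refl (NP.≤-<-trans q p))) (conj-beyond l x ps)

  nextRow : Cell → Cell
  nextRow c = proj₁ c , suc (proj₂ c)

  firstRow : ℕ → List Cell
  firstRow a = map (λ x → (x , 1)) (range 1 a)

  private
    cells-∷-tail : ∀ a l U → concat (map (λ y → map (λ x → (x , y)) (fromTo 1 (row (a ∷ l) y))) (map (2 +_) U))
              ≡ map nextRow (concat (map (λ y → map (λ x → (x , y)) (fromTo 1 (row l y))) (map (1 +_) U)))
    cells-∷-tail a l [] = refl
    cells-∷-tail a l (k ∷ U) = begin
      map (λ x → (x , suc (suc k))) (fromTo 1 (row l (suc k))) ++ _
        ≡⟨ cong₂ _++_ (LP.map-∘ (fromTo 1 (row l (suc k)))) (cells-∷-tail a l U) ⟩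
      map nextRow (map (λ x → (x , suc k)) (fromTo 1 (row l (suc k)))) ++ map nextRow _
        ≡⟨ sym (LP.map-++ nextRow (map (λ x → (x , suc k)) (fromTo 1 (row l (suc k)))) _) ⟩
      map nextRow (map (λ x → (x , suc k)) (fromTo 1 (row l (suc k))) ++ _) ∎
      where open ≡-Reasoning

  cells-∷ : ∀ a l → cells (a ∷ l) ≡ firstRow a ++ map nextRow (cells l)
  cells-∷ a l = trans (cong (λ z → concat (map G z)) (range-suc 1 (length l)))
    (cong (firstRow a ++_) (cells-∷-tail a l (upTo (length l))))
    where G = λ y → map (λ x → (x , y)) (fromTo 1 (row (a ∷ l) y))

  InDiagram : List ℕ → Cell → Set
  InDiagram κ c = 1 ≤ proj₁ c × proj₁ c ≤ row κ (proj₂ c) × 1 ≤ proj₂ c × proj₂ c ≤ length κ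

  firstRow-InDiagram : ∀ a → All (λ c → 1 ≤ proj₁ c × proj₁ c ≤ a × proj₂ c ≡ 1) (firstRow a)
  firstRow-InDiagram a = AllP.map⁺ (All.map (λ {k} p → proj₁ p , NP.≤-pred (proj₂ p) , refl) (range-bounds 1 a))

  cells-InDiagram : ∀ κ → All (InDiagram κ) (cells κ)
  cells-InDiagram [] = []
  cells-InDiagram (a ∷ l) rewrite cells-∷ a l = AllP.++⁺
    (All.map (λ { {x , y} (p1 , p2 , refl) → p1 , p2 , NP.≤-refl , s≤s z≤n }) (firstRow-InDiagram a))
    (AllP.map⁺ (All.map (λ { {x , suc y} (p1 , p2 , p3 , p4) → p1 , p2 , s≤s z≤n , s≤s p4 }) (cells-InDiagram l)))

  sumRange-conj-[] : ∀ b a → sumRange (conj (b ∷ [])) 1 a ≡ a ℕ.⊓ b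
  sumRange-conj-[] b zero = refl
  sumRange-conj-[] b (suc a) with suc a ≤? b
  ... | yes p = begin
    sumRange (conj (b ∷ [])) 1 (suc a) ≡⟨ sumRange-snoc (conj (b ∷ [])) 1 a ⟩
    sumRange (conj (b ∷ [])) 1 a + conj (b ∷ []) (suc a) ≡⟨ cong₂ _+_ (sumRange-conj-[] b a) (conj-[]-≤ p) ⟩
    a ℕ.⊓ b + 1 ≡⟨ cong (_+ 1) (NP.m≤n⇒m⊓n≡m (NP.≤-trans (NP.n≤1+n a) p)) ⟩
    a + 1 ≡⟨ NP.+-comm a 1 ⟩
    suc a ≡⟨ sym (NP.m≤n⇒m⊓n≡m p) ⟩
    suc a ℕ.⊓ b ∎
    where open ≡-Reasoning
  ... | no np = begin
    sumRange (conj (b ∷ [])) 1 (suc a) ≡⟨ sumRange-snoc (conj (b ∷ [])) 1 a ⟩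
    sumRange (conj (b ∷ [])) 1 a + conj (b ∷ []) (suc a) ≡⟨ cong₂ _+_ (sumRange-conj-[] b a) (conj-[]-≰ np) ⟩
    a ℕ.⊓ b + 0 ≡⟨ NP.+-identityʳ _ ⟩
    a ℕ.⊓ b ≡⟨ NP.m≥n⇒m⊓n≡n b≤a ⟩
    b ≡⟨ sym (NP.m≥n⇒m⊓n≡n (NP.≤-trans b≤a (NP.n≤1+n a))) ⟩
    suc a ℕ.⊓ b ∎
    where open ≡-Reasoning
          b≤a = NP.≤-pred (NP.≰⇒> np)

  sumRange-conj : ∀ l a → All (_≤ a) l → sumRange (conj l) 1 a ≡ sum l
  sumRange-conj [] a _ = sum-map-zero (range 1 a)
  sumRange-conj (b ∷ l) a (p ∷ ps) = begin
    sumRange (conj (b ∷ l)) 1 a ≡⟨ sumRange-cong 1 a (λ k _ → conj-∷ b l k) ⟩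
    sum (map (λ k → conj (b ∷ []) k + conj l k) (range 1 a)) ≡⟨ sum-map-+ (conj (b ∷ [])) (conj l) (range 1 a) ⟩
    sumRange (conj (b ∷ [])) 1 a + sumRange (conj l) 1 a ≡⟨ cong₂ _+_ (trans (sumRange-conj-[] b a) (NP.m≥n⇒m⊓n≡n p)) (sumRange-conj l a ps) ⟩
    b + sum l ∎
    where open ≡-Reasoning

  sum-map-++ : ∀ {A : Set} (f : A → ℕ) xs ys → sum (map f (xs ++ ys)) ≡ sum (map f xs) + sum (map f ys)
  sum-map-++ f xs ys = trans (cong sum (LP.map-++ f xs ys)) (sum-++ (map f xs) (map f ys))

  sum-map-∘ : ∀ {A B : Set} (f : B → ℕ) (g : A → B) xs → sum (map f (map g xs)) ≡ sum (map (f ∘ g) xs)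
  sum-map-∘ f g xs = cong sum (sym (LP.map-∘ xs))

  n-∷ : ∀ a l → Partition (a ∷ l) → nn (a ∷ l) ≡ sum l + nn l
  n-∷ a l p@(pa , h , pl) = begin
    sum (map L (cells (a ∷ l))) ≡⟨ cong (λ z → sum (map L z)) (cells-∷ a l) ⟩
    sum (map L (firstRow a ++ map nextRow (cells l))) ≡⟨ sum-map-++ L (firstRow a) _ ⟩
    sum (map L (firstRow a)) + sum (map L (map nextRow (cells l))) ≡⟨ cong₂ _+_ (sum-map-∘ L _ (range 1 a)) (sum-map-∘ L nextRow (cells l)) ⟩
    sum (map (λ x → L (x , 1)) (range 1 a)) + sum (map (L ∘ nextRow) (cells l))
      ≡⟨ cong₂ _+_ (sum-map-cong (All.map (λ {x} q → cong (_∸ 1) (conj-∷-≤ (NP.≤-pred (proj₂ q)))) (range-bounds 1 a)))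
                   (sum-map-cong (All.map (λ { {x , y} (_ , x≤row , _) → cong (_∸ suc y) (conj-∷-≤ (NP.≤-trans x≤row (tail-row≤head p y))) })
                                  (cells-InDiagram l))) ⟩
    sumRange (conj l) 1 a + nn l ≡⟨ cong (_+ nn l) (sumRange-conj l a (tail-All≤head p)) ⟩
    sum l + nn l ∎
    where open ≡-Reasoning
          L = leg (a ∷ l)

  rowArmSum : ℕ → ℕ
  rowArmSum a = sumRange (a ∸_) 1 a

  n′-∷ : ∀ a l → nn' (a ∷ l) ≡ rowArmSum a + nn' l
  n′-∷ a l = begin
    sum (map L (cells (a ∷ l))) ≡⟨ cong (λ z → sum (map L z)) (cells-∷ a l) ⟩
    sum (map L (firstRow a ++ map nextRow (cells l))) ≡⟨ sum-map-++ L (firstRow a) _ ⟩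
    sum (map L (firstRow a)) + sum (map L (map nextRow (cells l))) ≡⟨ cong₂ _+_ (sum-map-∘ L _ (range 1 a)) (sum-map-∘ L nextRow (cells l)) ⟩
    sum (map (λ x → L (x , 1)) (range 1 a)) + sum (map (L ∘ nextRow) (cells l))
      ≡⟨ cong (rowArmSum a +_) (sum-map-cong (All.map (λ { {x , suc y} _ → refl }) (cells-InDiagram l))) ⟩
    rowArmSum a + nn' l ∎
    where open ≡-Reasoning
          L = arm (a ∷ l)

  rowArmSum-suc : ∀ a → rowArmSum (suc a) ≡ rowArmSum a + a
  rowArmSum-suc a = begin
    sumRange (suc a ∸_) 1 (suc a) ≡⟨ sumRange-snoc (suc a ∸_) 1 a ⟩
    sumRange (suc a ∸_) 1 a + (a ∸ a) ≡⟨ cong₂ _+_ (sumRange-suc-∸ ) (NP.n∸n≡0 a) ⟩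
    sum (map (λ k → suc (a ∸ k)) (range 1 a)) + 0 ≡⟨ NP.+-identityʳ _ ⟩
    sum (map (λ k → suc (a ∸ k)) (range 1 a)) ≡⟨ sum-map-suc (a ∸_) (range 1 a) ⟩
    length (range 1 a) + rowArmSum a ≡⟨ cong (_+ rowArmSum a) (length-range 1 a) ⟩
    a + rowArmSum a ≡⟨ NP.+-comm a (rowArmSum a) ⟩
    rowArmSum a + a ∎
    where open ≡-Reasoning
          sumRange-suc-∸ : sumRange (suc a ∸_) 1 a ≡ sum (map (λ k → suc (a ∸ k)) (range 1 a))
          sumRange-suc-∸ = sum-map-cong (All.map (λ {k} q → NP.+-∸-assoc 1 (NP.≤-pred (proj₂ q))) (range-bounds 1 a))

  addCell-Partition : ∀ κ y0 → Partition κ → Addable κ y0 → Partition (addCell κ y0)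
  addCell-Partition [] (suc zero) _ _ = s≤s z≤n , z≤n , tt
  addCell-Partition (a ∷ l) (suc zero) (pa , h , p) _ = s≤s z≤n , NP.≤-trans h (NP.n≤1+n a) , p
  addCell-Partition (a ∷ []) (suc (suc zero)) (pa , h , p) ad = pa , pa , s≤s z≤n , z≤n , tt
  addCell-Partition (a ∷ b ∷ l) (suc (suc zero)) (pa , h , p) ad = pa , ad , addCell-Partition (b ∷ l) 1 p tt
  addCell-Partition (a ∷ b ∷ l) (suc (suc (suc k))) (pa , h , p) ad = pa , h , addCell-Partition (b ∷ l) (suc (suc k)) p ad

  sum-addCell : ∀ l y → 1 ≤ y → sum (addCell l y) ≡ suc (sum l)
  sum-addCell [] y _ = refl
  sum-addCell (a ∷ l) (suc zero) _ = refl
  sum-addCell (a ∷ l) (suc (suc k)) _ = trans (cong (a +_) (sum-addCell l (suc k) (s≤s z≤n))) (NP.+-suc a (sum l))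

  Addable-tail : ∀ a l k → Addable (a ∷ l) (suc (suc k)) → Addable l (suc k)
  Addable-tail a l zero _ = tt
  Addable-tail a l (suc k) ad = ad

  n-addCell : ∀ κ y0 → Partition κ → Addable κ y0 → nn (addCell κ y0) ≡ nn κ + (y0 ∸ 1)
  n-addCell [] (suc zero) _ _ = refl
  n-addCell (a ∷ l) (suc zero) p@(pa , h , pl) _ =
    trans (n-∷ (suc a) l (s≤s z≤n , NP.≤-trans h (NP.n≤1+n a) , pl)) (sym (trans (NP.+-identityʳ _) (n-∷ a l p)))
  n-addCell (a ∷ l) (suc (suc k)) p@(pa , h , pl) ad = begin
    nn (a ∷ addCell l (suc k)) ≡⟨ n-∷ a (addCell l (suc k)) (addCell-Partition (a ∷ l) (suc (suc k)) p ad) ⟩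
    sum (addCell l (suc k)) + nn (addCell l (suc k)) ≡⟨ cong₂ _+_ (sum-addCell l (suc k) (s≤s z≤n)) (n-addCell l (suc k) pl (Addable-tail a l k ad)) ⟩
    suc (sum l) + (nn l + k) ≡⟨ solve 3 (λ a b c → con 1 :+ a :+ (b :+ c) := (a :+ b) :+ (con 1 :+ c)) refl (sum l) (nn l) k ⟩
    (sum l + nn l) + suc k ≡⟨ cong (_+ suc k) (sym (n-∷ a l p)) ⟩
    nn (a ∷ l) + suc k ∎
    where open ≡-Reasoning

  n′-addCell : ∀ κ y0 → 1 ≤ y0 → nn' (addCell κ y0) ≡ nn' κ + row κ y0
  n′-addCell [] (suc zero) _ = refl
  n′-addCell [] (suc (suc k)) _ = refl
  n′-addCell (a ∷ l) (suc zero) _ = begin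
    nn' (suc a ∷ l) ≡⟨ n′-∷ (suc a) l ⟩
    rowArmSum (suc a) + nn' l ≡⟨ cong (_+ nn' l) (rowArmSum-suc a) ⟩
    rowArmSum a + a + nn' l ≡⟨ solve 3 (λ a b c → a :+ b :+ c := a :+ c :+ b) refl (rowArmSum a) a (nn' l) ⟩
    rowArmSum a + nn' l + a ≡⟨ cong (_+ a) (sym (n′-∷ a l)) ⟩
    nn' (a ∷ l) + a ∎
    where open ≡-Reasoning
  n′-addCell (a ∷ l) (suc (suc k)) _ = begin
    nn' (a ∷ addCell l (suc k)) ≡⟨ n′-∷ a _ ⟩
    rowArmSum a + nn' (addCell l (suc k)) ≡⟨ cong (rowArmSum a +_) (n′-addCell l (suc k) (s≤s z≤n)) ⟩
    rowArmSum a + (nn' l + row l (suc k)) ≡⟨ sym (NP.+-assoc (rowArmSum a) _ _) ⟩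
    rowArmSum a + nn' l + row l (suc k) ≡⟨ cong (_+ row l (suc k)) (sym (n′-∷ a l)) ⟩
    nn' (a ∷ l) + row l (suc k) ∎
    where open ≡-Reasoning

  row-addCell-same : ∀ κ y → 1 ≤ y → y ≤ suc (length κ) → row (addCell κ y) y ≡ suc (row κ y)
  row-addCell-same [] (suc zero) _ _ = refl
  row-addCell-same [] (suc (suc k)) _ (s≤s ())
  row-addCell-same (a ∷ l) (suc zero) _ _ = refl
  row-addCell-same (a ∷ l) (suc (suc k)) _ (s≤s h) = row-addCell-same l (suc k) (s≤s z≤n) h

  row-addCell-other : ∀ κ y0 y → y ≢ y0 → 1 ≤ y → y ≤ length κ → row (addCell κ y0) y ≡ row κ y
  row-addCell-other [] y0 (suc y) ne _ ()
  row-addCell-other (a ∷ l) zero y ne _ _ = refl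
  row-addCell-other (a ∷ l) (suc zero) (suc zero) ne _ _ = ⊥-elim (ne refl)
  row-addCell-other (a ∷ l) (suc zero) (suc (suc k)) ne _ _ = refl
  row-addCell-other (a ∷ l) (suc (suc k0)) (suc zero) ne _ _ = refl
  row-addCell-other (a ∷ l) (suc (suc k0)) (suc (suc k)) ne _ (s≤s h) =
    row-addCell-other l (suc k0) (suc k) (λ e → ne (cong suc e)) (s≤s z≤n) h

  conj-[]-suc : ∀ a x → x ≢ suc a → conj (suc a ∷ []) x ≡ conj (a ∷ []) x
  conj-[]-suc a x ne with x ≤? a
  ... | yes p = trans (conj-[]-≤ (NP.≤-trans p (NP.n≤1+n a))) (sym (conj-[]-≤ p))
  ... | no np = trans (conj-[]-≰ (λ q → ne (NP.≤-antisym q (NP.≰⇒> np)))) (sym (conj-[]-≰ np))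

  conj-addCell-other : ∀ κ y0 x → 1 ≤ x → x ≢ suc (row κ y0) → conj (addCell κ y0) x ≡ conj κ x
  conj-addCell-other [] y0 x px ne = trans (conj-∷ 1 [] x) (cong (_+ 0) (conj-[]-≰ (λ q → ne (NP.≤-antisym q px))))
  conj-addCell-other (a ∷ l) zero x px ne = refl
  conj-addCell-other (a ∷ l) (suc zero) x px ne =
    trans (conj-∷ (suc a) l x) (trans (cong (_+ conj l x) (conj-[]-suc a x ne)) (sym (conj-∷ a l x)))
  conj-addCell-other (a ∷ l) (suc (suc k)) x px ne =
    trans (conj-∷ a (addCell l (suc k)) x) (trans (cong (conj (a ∷ []) x +_) (conj-addCell-other l (suc k) x px ne)) (sym (conj-∷ a l x)))

  conj-addCell-same : ∀ κ y0 → 1 ≤ y0 → conj (addCell κ y0) (suc (row κ y0)) ≡ suc (conj κ (suc (row κ y0)))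
  conj-addCell-same [] (suc y) _ = refl
  conj-addCell-same (a ∷ l) (suc zero) _ =
    trans (conj-∷-≤ {suc a} {l} {suc a} NP.≤-refl) (cong suc (sym (conj-∷-≰ {a} {l} {suc a} (NP.<-irrefl refl))))
  conj-addCell-same (a ∷ l) (suc (suc k)) _ = begin
    conj (a ∷ addCell l (suc k)) x ≡⟨ conj-∷ a _ x ⟩
    conj (a ∷ []) x + conj (addCell l (suc k)) x ≡⟨ cong (conj (a ∷ []) x +_) (conj-addCell-same l (suc k) (s≤s z≤n)) ⟩
    conj (a ∷ []) x + suc (conj l x) ≡⟨ NP.+-suc _ _ ⟩
    suc (conj (a ∷ []) x + conj l x) ≡⟨ cong suc (sym (conj-∷ a l x)) ⟩
    suc (conj (a ∷ l) x) ∎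
    where open ≡-Reasoning
          x = suc (row l (suc k))

  ≤row⇒≤conj : ∀ κ → Partition κ → ∀ y x → 1 ≤ y → 1 ≤ x → x ≤ row κ y → y ≤ conj κ x
  ≤row⇒≤conj [] _ (suc y) x _ px h = ⊥-elim (NP.<-irrefl refl (NP.<-≤-trans px h))
  ≤row⇒≤conj (a ∷ l) p (suc zero) x _ px h = subst (1 ≤_) (sym (conj-∷-≤ h)) (s≤s z≤n)
  ≤row⇒≤conj (a ∷ l) p@(_ , _ , pl) (suc (suc k)) x _ px h =
    subst (suc (suc k) ≤_) (sym (conj-∷-≤ (NP.≤-trans h (tail-row≤head p (suc k))))) (s≤s (≤row⇒≤conj l pl (suc k) x (s≤s z≤n) px h))

  Addable⇒row< : ∀ κ k → Addable κ (suc (suc k)) → row κ (suc (suc k)) < row κ (suc k)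
  Addable⇒row< (a ∷ l) zero ad = ad
  Addable⇒row< (a ∷ l) (suc k) ad = Addable⇒row< l k ad

  conj-addCell-column : ∀ κ y0 → Partition κ → Addable κ y0 → conj κ (suc (row κ y0)) ≡ y0 ∸ 1
  conj-addCell-column [] (suc zero) _ _ = refl
  conj-addCell-column (a ∷ l) (suc zero) p _ = conj-beyond (a ∷ l) (suc a) (s≤s NP.≤-refl ∷ All.map s≤s (tail-All≤head p))
  conj-addCell-column (a ∷ l) (suc (suc zero)) p@(_ , _ , pl) ad = trans (conj-∷-≤ ad) (cong suc (conj-addCell-column l 1 pl tt))
  conj-addCell-column (a ∷ l) (suc (suc (suc k))) p@(_ , _ , pl) ad =
    trans (conj-∷-≤ (NP.≤-trans (Addable⇒row< l k ad) (tail-row≤head p (suc k)))) (cong suc (conj-addCell-column l (suc (suc k)) pl ad))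

  length-filter-cells-∷ : ∀ {P : Pred Cell 0ℓ} (P? : Decidable P) a l →
    length (filter P? (cells (a ∷ l))) ≡ length (filter P? (firstRow a)) + length (filter P? (map nextRow (cells l)))
  length-filter-cells-∷ P? a l = trans (cong (λ z → length (filter P? z)) (cells-∷ a l))
    (trans (cong length (LP.filter-++ P? (firstRow a) (map nextRow (cells l)))) (LP.length-++ (filter P? (firstRow a))))

  length-Rset : ∀ κ y0 → 1 ≤ y0 → length (Rset κ y0) ≡ row κ y0
  length-Rset [] y0 _ = refl
  length-Rset (a ∷ l) y0 py = trans (length-filter-cells-∷ (λ (c : Cell) → proj₂ c ≟ y0) a l) (go y0 py)
    where
    go : ∀ y0 → 1 ≤ y0 → length (filter (λ (c : Cell) → proj₂ c ≟ y0) (firstRow a))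
                       + length (filter (λ (c : Cell) → proj₂ c ≟ y0) (map nextRow (cells l))) ≡ row (a ∷ l) y0
    go (suc zero) _ = trans (cong₂ _+_ (trans (cong length (LP.filter-all (λ (c : Cell) → proj₂ c ≟ 1) (All.map (λ q → proj₂ (proj₂ q)) (firstRow-InDiagram a))))
                                        (trans (LP.length-map _ (range 1 a)) (length-range 1 a)))
                                        (cong length (LP.filter-none (λ (c : Cell) → proj₂ c ≟ 1)
                                          (AllP.map⁺ (All.map (λ { {x , suc y} _ () }) (cells-InDiagram l))))))
                   (NP.+-identityʳ a)
    go (suc (suc k)) _ = cong₂ _+_
       (cong length (LP.filter-none (λ (c : Cell) → proj₂ c ≟ suc (suc k)) (All.map (λ q e → 1≢2+k (trans (sym (proj₂ (proj₂ q))) e)) (firstRow-InDiagram a))))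
       (trans (cong length (filter-map-comm (λ (c : Cell) → proj₂ c ≟ suc (suc k)) (λ (c : Cell) → proj₂ c ≟ suc k) nextRow (λ _ → refl) (cells l)))
              (trans (LP.length-map nextRow (filter (λ (c : Cell) → proj₂ c ≟ suc k) (cells l))) (length-Rset l (suc k) (s≤s z≤n))))
      where 1≢2+k : 1 ≢ suc (suc k)
            1≢2+k ()

  count-range-snoc : ∀ a x → length (filter (_≟ x) (range 1 (suc a)))
                               ≡ length (filter (_≟ x) (range 1 a)) + length (filter (_≟ x) (suc a ∷ []))
  count-range-snoc a x = trans (cong (λ z → length (filter (_≟ x) z)) (range-snoc 1 a))
    (trans (cong length (LP.filter-++ (_≟ x) (range 1 a) (suc a ∷ []))) (LP.length-++ (filter (_≟ x) (range 1 a))))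

  count-range : ∀ a x → 1 ≤ x → length (filter (_≟ x) (range 1 a)) ≡ conj (a ∷ []) x
  count-range zero x 1≤x = sym (conj-[]-≰ (λ x≤0 → NP.<-irrefl refl (NP.<-≤-trans 1≤x x≤0)))
  count-range (suc a) x 1≤x with NP.<-cmp x (suc a)
  ... | tri< x<1+a x≢1+a _ = trans (count-range-snoc a x)
    (trans (cong₂ _+_ (trans (count-range a x 1≤x) (conj-[]-≤ (NP.≤-pred x<1+a)))
                      (cong length (LP.filter-reject (_≟ x) (λ e → x≢1+a (sym e)))))
           (sym (conj-[]-≤ (NP.<⇒≤ x<1+a))))
  ... | tri≈ _ refl _ = trans (count-range-snoc a x)
    (trans (cong₂ _+_ (trans (count-range a x 1≤x) (conj-[]-≰ {a} {suc a} (NP.<-irrefl refl)))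
                      (cong length (LP.filter-accept (_≟ x) {x = suc a} {xs = []} refl)))
           (sym (conj-[]-≤ {suc a} {suc a} NP.≤-refl)))
  ... | tri> _ x≢1+a 1+a<x = trans (count-range-snoc a x)
    (trans (cong₂ _+_ (trans (count-range a x 1≤x) (conj-[]-≰ (λ x≤a → NP.≤⇒≯ x≤a (NP.<-trans (NP.n<1+n a) 1+a<x))))
                      (cong length (LP.filter-reject (_≟ x) (λ e → x≢1+a (sym e)))))
           (sym (conj-[]-≰ (λ x≤1+a → NP.≤⇒≯ x≤1+a 1+a<x))))

  length-column : ∀ κ x → 1 ≤ x → length (filter (λ (c : Cell) → proj₁ c ≟ x) (cells κ)) ≡ conj κ x
  length-column [] x _ = refl
  length-column (a ∷ l) x px = trans (length-filter-cells-∷ P? a l)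
                      (trans (cong₂ _+_
                          (trans (cong length (filter-map-comm P? (_≟ x) (λ x' → (x' , 1)) (λ _ → refl) (range 1 a)))
                                 (trans (LP.length-map (λ x' → (x' , 1)) (filter (_≟ x) (range 1 a))) (count-range a x px)))
                          (trans (cong length (filter-map-comm P? P? nextRow (λ _ → refl) (cells l)))
                                 (trans (LP.length-map nextRow (filter P? (cells l))) (length-column l x px))))
                      (sym (conj-∷ a l x)))
    where
    P? = λ (c : Cell) → proj₁ c ≟ x


  row-addCell-mono : ∀ κ y0 y → row κ y ≤ row (addCell κ y0) y
  row-addCell-mono [] y0 y = z≤n
  row-addCell-mono (a ∷ l) zero y = NP.≤-refl
  row-addCell-mono (a ∷ l) (suc zero) zero = z≤n
  row-addCell-mono (a ∷ l) (suc zero) (suc zero) = NP.n≤1+n a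
  row-addCell-mono (a ∷ l) (suc zero) (suc (suc k)) = NP.≤-refl
  row-addCell-mono (a ∷ l) (suc (suc k0)) zero = z≤n
  row-addCell-mono (a ∷ l) (suc (suc k0)) (suc zero) = NP.≤-refl
  row-addCell-mono (a ∷ l) (suc (suc k0)) (suc (suc k)) = row-addCell-mono l (suc k0) (suc k)

  RemoveCellSpec : List ℕ → ℕ → Set
  RemoveCellSpec l y = Partition (removeCell l y) × Addable (removeCell l y) y
                     × addCell (removeCell l y) y ≡ l × row (removeCell l y) y ≡ row l y ∸ 1

  removeCell-spec : ∀ l y → Partition l → Removable l y → RemoveCellSpec l y
  removeCell-spec (zero ∷ l) y (() , _) _
  removeCell-spec (suc zero ∷ []) (suc zero) p _ = tt , tt , refl , refl
  removeCell-spec (suc zero ∷ b ∷ l) (suc zero) (_ , _ , pb , _) (s≤s b≤0) = ⊥-elim (NP.<-irrefl refl (NP.<-≤-trans pb b≤0))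
  removeCell-spec (suc (suc a) ∷ l) (suc zero) (pa , h , pl) r =
    subst (λ z → Partition z × Addable z 1 × addCell z 1 ≡ suc (suc a) ∷ l × row z 1 ≡ suc a) (sym e)
     ((s≤s z≤n , NP.≤-pred r , pl) , tt , refl , refl)
    where e : removeCell (suc (suc a) ∷ l) 1 ≡ suc a ∷ l
          e = cong (suc a ∷_) (LP.filter-all (1 ≤?_) (All-positive l pl))
  removeCell-spec (suc a ∷ l) (suc (suc k)) p@(pa , h , pl) r with removeCell-spec l (suc k) pl r
  ... | pm , adm , eq , rw = (pa , NP.≤-trans (subst (at (removeCell l (suc k)) 1 ≤_) (cong (λ z → at z 1) eq) (row-addCell-mono (removeCell l (suc k)) (suc k) 1)) h , pm)
                           , extend k r adm rw , cong (suc a ∷_) eq , rw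
    where
    extend : ∀ k → Removable l (suc k) → Addable (removeCell l (suc k)) (suc k) → row (removeCell l (suc k)) (suc k) ≡ row l (suc k) ∸ 1
         → Addable (suc a ∷ removeCell l (suc k)) (suc (suc k))
    extend zero r _ rw = subst (_< suc a) (sym rw) (pred-head< l pl r h)
      where pred-head< : ∀ l → Partition l → Removable l 1 → at l 1 ≤ suc a → at l 1 ∸ 1 < suc a
            pred-head< (suc b ∷ l) _ _ h = h
            pred-head< (zero ∷ l) (() , _) _ _
    extend (suc k) _ ad _ = ad

  -- Distinct part sizes and their multiplicities

  All≤head : ∀ l → Partition l → All (_≤ at l 1) l
  All≤head [] _ = []
  All≤head (b ∷ l) p = NP.≤-refl ∷ tail-All≤head p

  UsStep : ℕ → List ℕ → Set
  UsStep a l = (at l 1 < a × us (a ∷ l) ≡ a ∷ us l) ⊎ (at l 1 ≡ a × us (a ∷ l) ≡ us l)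

  us-∷ : ∀ a l → Partition (a ∷ l) → UsStep a l
  us-∷ a l p@(pa , h , pl) with NP.m≤n⇒m<n∨m≡n h
  ... | inj₁ lt = inj₁ (lt , cong (a ∷_) (LP.filter-all G
    (AllP.deduplicate⁺ ℕ._≟_ (All.map (λ q e → NP.<-irrefl (sym e) (NP.≤-<-trans q lt)) (All≤head l pl)))))
    where G = λ y → Relation.Nullary.¬? (a ≟ y)
  us-∷ a [] (pa , h , pl) | inj₂ eq = ⊥-elim (NP.<-irrefl eq pa)
  us-∷ a (b ∷ l) (pa , h , pl) | inj₂ refl = inj₂ (refl , cong (b ∷_) (trans (LP.filter-reject G {x = b} (λ n → n refl)) (LP.filter-idem G (us l))))
    where G = λ y → Relation.Nullary.¬? (b ≟ y)

  StrictlyDecreasing : List ℕ → Set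
  StrictlyDecreasing [] = ⊤
  StrictlyDecreasing (x ∷ xs) = at xs 1 < x × StrictlyDecreasing xs

  uu-1 : ∀ l → uu l 1 ≡ at l 1
  uu-1 [] = refl
  uu-1 (a ∷ l) = refl

  us-StrictlyDecreasing : ∀ l → Partition l → StrictlyDecreasing (us l)
  us-StrictlyDecreasing [] _ = tt
  us-StrictlyDecreasing (a ∷ l) p@(_ , _ , pl) with us-∷ a l p
  ... | inj₁ (lt , e) = subst StrictlyDecreasing (sym e) (subst (_< a) (sym (uu-1 l)) lt , us-StrictlyDecreasing l pl)
  ... | inj₂ (_ , e) = subst StrictlyDecreasing (sym e) (us-StrictlyDecreasing l pl)

  StrictlyDecreasing-head : ∀ x xs → StrictlyDecreasing (x ∷ xs) → ∀ j → at xs j < x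
  StrictlyDecreasing-head x [] (lt , _) j = lt
  StrictlyDecreasing-head x (y ∷ ys) (lt , d) zero = NP.≤-<-trans z≤n lt
  StrictlyDecreasing-head x (y ∷ ys) (lt , d) (suc zero) = lt
  StrictlyDecreasing-head x (y ∷ ys) (lt , d) (suc (suc k)) = NP.<-trans (StrictlyDecreasing-head y ys d (suc k)) lt

  at-suc≤at : ∀ xs → StrictlyDecreasing xs → ∀ i → 1 ≤ i → at xs (suc i) ≤ at xs i
  at-suc≤at [] _ i _ = z≤n
  at-suc≤at (x ∷ xs) (lt , d) (suc zero) _ = NP.<⇒≤ lt
  at-suc≤at (x ∷ xs) (lt , d) (suc (suc k)) _ = at-suc≤at xs d (suc k) (s≤s z≤n)

  at-suc<at : ∀ xs → StrictlyDecreasing xs → ∀ i → 1 ≤ i → i ≤ length xs → at xs (suc i) < at xs i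
  at-suc<at (x ∷ xs) (lt , d) (suc zero) _ _ = lt
  at-suc<at (x ∷ xs) (lt , d) (suc (suc k)) _ (s≤s h) = at-suc<at xs d (suc k) (s≤s z≤n) h

  at-beyond : ∀ xs i → length xs < i → at xs i ≡ 0
  at-beyond [] i _ = refl
  at-beyond (x ∷ xs) (suc zero) (s≤s ())
  at-beyond (x ∷ xs) (suc (suc k)) (s≤s h) = at-beyond xs (suc k) h

  module Params∷ (a : ℕ) (l : List ℕ) (p : Partition (a ∷ l)) where
    pl = Partition-tail p

    dd-∷-new : at l 1 < a → us (a ∷ l) ≡ a ∷ us l → dd (a ∷ l) ≡ suc (dd l)
    dd-∷-new _ e = cong length e
    uu-∷-new : at l 1 < a → us (a ∷ l) ≡ a ∷ us l → ∀ k → uu (a ∷ l) (suc (suc k)) ≡ uu l (suc k)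
    uu-∷-new _ e k = cong (λ z → at z (suc (suc k))) e
    vv-∷-new-1 : at l 1 < a → vv (a ∷ l) 1 ≡ 1
    vv-∷-new-1 lt = trans (cong length (LP.filter-accept (_≟ a) {x = a} {xs = l} refl))
                    (cong suc (cong length (LP.filter-none (_≟ a) (All.map (λ q e → NP.<-irrefl e (NP.≤-<-trans q lt)) (All≤head l pl)))))
    vv-∷-new-suc : (lt : at l 1 < a) → (e : us (a ∷ l) ≡ a ∷ us l) → ∀ k → vv (a ∷ l) (suc (suc k)) ≡ vv l (suc k)
    vv-∷-new-suc lt e k = trans (cong (λ u → length (filter (_≟ u) (a ∷ l))) (uu-∷-new lt e k))
                  (cong length (LP.filter-reject (_≟ uu l (suc k)) {x = a} {xs = l}
                     (λ eq → NP.<-irrefl (sym eq) (StrictlyDecreasing-head a (us l) (subst StrictlyDecreasing e (us-StrictlyDecreasing (a ∷ l) p)) (suc k)))))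

    dd-∷-repeat : at l 1 ≡ a → us (a ∷ l) ≡ us l → dd (a ∷ l) ≡ dd l
    dd-∷-repeat _ e = cong length e
    uu-∷-repeat : at l 1 ≡ a → us (a ∷ l) ≡ us l → ∀ i → uu (a ∷ l) i ≡ uu l i
    uu-∷-repeat _ e i = cong (λ z → at z i) e
    vv-∷-repeat-1 : at l 1 ≡ a → vv (a ∷ l) 1 ≡ suc (vv l 1)
    vv-∷-repeat-1 eq = trans (cong length (LP.filter-accept (_≟ a) {x = a} {xs = l} refl))
                    (cong suc (cong (λ u → length (filter (_≟ u) l)) (sym (trans (uu-1 l) eq))))
    vv-∷-repeat-suc : (eq : at l 1 ≡ a) → (e : us (a ∷ l) ≡ us l) → ∀ k → vv (a ∷ l) (suc (suc k)) ≡ vv l (suc (suc k))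
    vv-∷-repeat-suc eq e k = trans (cong (λ u → length (filter (_≟ u) (a ∷ l))) (uu-∷-repeat eq e (suc (suc k))))
                  (cong length (LP.filter-reject (_≟ uu l (suc (suc k))) {x = a} {xs = l} (λ q → head-not-later l pl eq q)))
      where
      head-not-later : ∀ l → Partition l → at l 1 ≡ a → a ≢ uu l (suc (suc k))
      head-not-later [] _ eq' _ = NP.<-irrefl eq' (proj₁ p)
      head-not-later (b ∷ l') pb refl q = NP.<-irrefl (sym q) (StrictlyDecreasing-head b _ (us-StrictlyDecreasing (b ∷ l') pb) (suc k))

  vs-1-suc : ∀ l s → vs l 1 (suc s) ≡ vv l 1 + sumRange (vv l ∘ suc) 1 s
  vs-1-suc l s = trans (sumRange-suc (vv l) 1 s)
    (cong (vv l 1 +_) (trans (sum-map-∘ (vv l) (2 +_) (upTo s)) (sym (sum-map-∘ (vv l ∘ suc) (1 +_) (upTo s)))))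

  vs-∷-new : ∀ a l → (p : Partition (a ∷ l)) → at l 1 < a → us (a ∷ l) ≡ a ∷ us l → ∀ s → vs (a ∷ l) 1 (suc s) ≡ suc (vs l 1 s)
  vs-∷-new a l p lt e s = trans (vs-1-suc (a ∷ l) s) (cong₂ _+_ (Params∷.vv-∷-new-1 a l p lt)
       (sumRange-cong 1 s (λ { (suc k) _ → Params∷.vv-∷-new-suc a l p lt e k })))

  vs-∷-repeat : ∀ a l → (p : Partition (a ∷ l)) → at l 1 ≡ a → us (a ∷ l) ≡ us l → ∀ s → vs (a ∷ l) 1 (suc s) ≡ suc (vs l 1 (suc s))
  vs-∷-repeat a l p eq e s = trans (vs-1-suc (a ∷ l) s) (trans (cong₂ _+_ (Params∷.vv-∷-repeat-1 a l p eq)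
       (sumRange-cong 1 s (λ { (suc k) _ → Params∷.vv-∷-repeat-suc a l p eq e k }))) (cong suc (sym (vs-1-suc l s))))

  vv-∷-1-positive : ∀ b l → 1 ≤ vv (b ∷ l) 1
  vv-∷-1-positive b l = subst (1 ≤_) (sym (cong length (LP.filter-accept (_≟ b) {x = b} {xs = l} refl))) (s≤s z≤n)

  vv-1≤vs : ∀ l s → vv l 1 ≤ vs l 1 (suc s)
  vv-1≤vs l s = subst (vv l 1 ≤_) (sym (vs-1-suc l s)) (NP.m≤m+n _ _)

  vs-repeat-positive : ∀ a l → Partition (a ∷ l) → at l 1 ≡ a → ∀ s → 1 ≤ vs l 1 (suc s)
  vs-repeat-positive a [] p eq s = ⊥-elim (NP.<-irrefl eq (proj₁ p))
  vs-repeat-positive a (b ∷ l') p eq s = NP.≤-trans (vv-∷-1-positive b l') (vv-1≤vs (b ∷ l') s)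

  plusS-corner : ∀ l s → Partition l → s ≤ dd l → row l (suc (vs l 1 s)) ≡ uu l (suc s) × Addable l (suc (vs l 1 s))
  plusS-corner l zero p _ = sym (uu-1 l) , tt
  plusS-corner [] (suc s) p ()
  plusS-corner (a ∷ l) (suc s) p h with us-∷ a l p
  ... | inj₁ (lt , e) = subst (λ v → row (a ∷ l) (suc v) ≡ uu (a ∷ l) (suc (suc s)) × Addable (a ∷ l) (suc v)) (sym (vs-∷-new a l p lt e s))
        (trans (proj₁ ih) (sym (Params∷.uu-∷-new a l p lt e s)) , step (vs l 1 s) (proj₂ ih))
    where
    ih = plusS-corner l s (Partition-tail p) (NP.≤-pred (subst (suc s ≤_) (Params∷.dd-∷-new a l p lt e) h))
    step : ∀ w → Addable l (suc w) → Addable (a ∷ l) (suc (suc w))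
    step zero _ = lt
    step (suc w) ad = ad
  ... | inj₂ (eq , e) = subst (λ v → row (a ∷ l) (suc v) ≡ uu (a ∷ l) (suc (suc s)) × Addable (a ∷ l) (suc v)) (sym (vs-∷-repeat a l p eq e s))
        (trans (proj₁ ih) (sym (Params∷.uu-∷-repeat a l p eq e (suc (suc s)))) , step (vs l 1 (suc s)) pos (proj₂ ih))
    where
    ih = plusS-corner l (suc s) (Partition-tail p) (subst (suc s ≤_) (Params∷.dd-∷-repeat a l p eq e) h)
    pos = vs-repeat-positive a l p eq s
    step : ∀ w → 1 ≤ w → Addable l (suc w) → Addable (a ∷ l) (suc (suc w))
    step (suc w) _ ad = ad

  Removable-∷ : ∀ a l w → Removable l w → Removable (a ∷ l) (suc w) × row (a ∷ l) (suc w) ≡ row l w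
  Removable-∷ a (b ∷ l) (suc w) r = r , refl

  minusR-corner : ∀ l r → Partition l → 1 ≤ r → r ≤ dd l → Removable l (vs l 1 r) × row l (vs l 1 r) ≡ uu l r
  minusR-corner [] (suc r) p _ ()
  minusR-corner (a ∷ l) (suc r) p _ h with us-∷ a l p
  ... | inj₁ (lt , e) = subst (λ v → Removable (a ∷ l) v × row (a ∷ l) v ≡ uu (a ∷ l) (suc r)) (sym (vs-∷-new a l p lt e r)) (go r h)
    where
    go : ∀ r → suc r ≤ dd (a ∷ l) → Removable (a ∷ l) (suc (vs l 1 r)) × row (a ∷ l) (suc (vs l 1 r)) ≡ uu (a ∷ l) (suc r)
    go zero _ = lt , refl
    go (suc r) h with minusR-corner l (suc r) (Partition-tail p) (s≤s z≤n) (NP.≤-pred (subst (suc (suc r) ≤_) (Params∷.dd-∷-new a l p lt e) h))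
    ... | (rm , rw) = proj₁ (Removable-∷ a l _ rm) , trans (proj₂ (Removable-∷ a l _ rm)) (trans rw (sym (Params∷.uu-∷-new a l p lt e r)))
  ... | inj₂ (eq , e) with minusR-corner l (suc r) (Partition-tail p) (s≤s z≤n) (subst (suc r ≤_) (Params∷.dd-∷-repeat a l p eq e) h)
  ... | (rm , rw) = subst (λ v → Removable (a ∷ l) v × row (a ∷ l) v ≡ uu (a ∷ l) (suc r)) (sym (vs-∷-repeat a l p eq e r))
        (proj₁ (Removable-∷ a l _ rm) , trans (proj₂ (Removable-∷ a l _ rm)) (trans rw (sym (Params∷.uu-∷-repeat a l p eq e (suc r)))))

  vv-positive : ∀ l i → Partition l → 1 ≤ i → i ≤ dd l → 1 ≤ vv l i
  vv-positive [] (suc i) p _ ()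
  vv-positive (a ∷ l) (suc i) p _ h with us-∷ a l p
  vv-positive (a ∷ l) (suc zero) p _ h | inj₁ (lt , e) = subst (1 ≤_) (sym (Params∷.vv-∷-new-1 a l p lt)) (s≤s z≤n)
  vv-positive (a ∷ l) (suc (suc k)) p _ h | inj₁ (lt , e) = subst (1 ≤_) (sym (Params∷.vv-∷-new-suc a l p lt e k))
     (vv-positive l (suc k) (Partition-tail p) (s≤s z≤n) (NP.≤-pred (subst (suc (suc k) ≤_) (Params∷.dd-∷-new a l p lt e) h)))
  vv-positive (a ∷ l) (suc zero) p _ h | inj₂ (eq , e) = subst (1 ≤_) (sym (Params∷.vv-∷-repeat-1 a l p eq)) (s≤s z≤n)
  vv-positive (a ∷ l) (suc (suc k)) p _ h | inj₂ (eq , e) = subst (1 ≤_) (sym (Params∷.vv-∷-repeat-suc a l p eq e k))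
     (vv-positive l (suc (suc k)) (Partition-tail p) (s≤s z≤n) (subst (suc (suc k) ≤_) (Params∷.dd-∷-repeat a l p eq e) h))

  uu-beyond-dd : ∀ l → uu l (suc (dd l)) ≡ 0
  uu-beyond-dd l = at-beyond (us l) (suc (dd l)) NP.≤-refl

  hs-telescope : ∀ l → Partition l → ∀ i j → 1 ≤ i → i ≤ suc j → hs l i j + uu l (suc j) ≡ uu l i
  hs-telescope l p i j pi h = trans (cong (λ z → hs l i j + uu l z) (sym (NP.m+[n∸m]≡n h)))
    (sumRange-telescope (uu l) i (suc j ∸ i) (λ k q → at-suc≤at (us l) (us-StrictlyDecreasing l p) k (NP.≤-trans pi q)))

  vs-split : ∀ l i j k → i ≤ suc j → j ≤ k → vs l i j + vs l (suc j) k ≡ vs l i k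
  vs-split l i j k h1 h2 = begin
    sumRange (vv l) i m + sumRange (vv l) (suc j) n ≡⟨ cong (λ z → sumRange (vv l) i m + sumRange (vv l) z n) (sym e1) ⟩
    sumRange (vv l) i m + sumRange (vv l) (i + m) n ≡⟨ sym (sumRange-+ (vv l) i m n) ⟩
    sumRange (vv l) i (m + n) ≡⟨ cong (sumRange (vv l) i) e2 ⟩
    sumRange (vv l) i (suc k ∸ i) ∎
    where open ≡-Reasoning
          m = suc j ∸ i
          n = suc k ∸ suc j
          e1 : i + m ≡ suc j
          e1 = NP.m+[n∸m]≡n h1
          e2 : m + n ≡ suc k ∸ i
          e2 = begin
            m + n ≡⟨ sym (NP.m+n∸m≡n i (m + n)) ⟩
            i + (m + n) ∸ i ≡⟨ cong (_∸ i) (sym (NP.+-assoc i m n)) ⟩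
            (i + m) + n ∸ i ≡⟨ cong (λ z → z + n ∸ i) e1 ⟩
            suc j + n ∸ i ≡⟨ cong (_∸ i) (NP.m+[n∸m]≡n (s≤s h2)) ⟩
            suc k ∸ i ∎

  vs-single : ∀ l r → vs l r r ≡ vv l r
  vs-single l r = trans (cong (sumRange (vv l) r) (NP.m+n∸n≡m 1 r)) (trans (NP.+-identityʳ _) (cong (vv l) (NP.+-identityʳ r)))

  Addable⇒positive : ∀ κ y0 → Addable κ y0 → 1 ≤ y0
  Addable⇒positive κ (suc y) _ = s≤s z≤n

  Rset-InDiagram : ∀ κ y0 → All (λ c → InDiagram κ c × proj₂ c ≡ y0) (Rset κ y0)
  Rset-InDiagram κ y0 = All.zip (AllP.filter⁺ P? (cells-InDiagram κ) , AllP.all-filter P? (cells κ))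
    where P? = λ (c : Cell) → proj₂ c ≟ y0

  Cset-InDiagram : ∀ κ y0 → All (λ c → InDiagram κ c × proj₁ c ≡ suc (row κ y0)) (Cset κ y0)
  Cset-InDiagram κ y0 = All.zip (AllP.filter⁺ P? (cells-InDiagram κ) , AllP.all-filter P? (cells κ))
    where P? = λ (c : Cell) → proj₁ c ≟ suc (row κ y0)

  Rset-arm-leg : ∀ κ y0 c → InDiagram κ c → proj₂ c ≡ y0 →
                 arm (addCell κ y0) c ≡ suc (arm κ c) × leg (addCell κ y0) c ≡ leg κ c
  Rset-arm-leg κ y0 (x , y) (1≤x , x≤row , 1≤y , y≤len) refl =
    trans (cong (_∸ x) (row-addCell-same κ y 1≤y (NP.≤-trans y≤len (NP.n≤1+n _)))) (NP.+-∸-assoc 1 x≤row)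
    , cong (_∸ y) (conj-addCell-other κ y x 1≤x (λ e → NP.<-irrefl e (s≤s x≤row)))

  Cset-arm-leg : ∀ κ y0 c → Partition κ → 1 ≤ y0 → InDiagram κ c → proj₁ c ≡ suc (row κ y0) →
                 arm (addCell κ y0) c ≡ arm κ c × leg (addCell κ y0) c ≡ suc (leg κ c)
  Cset-arm-leg κ y0 (x , y) p 1≤y0 (1≤x , x≤row , 1≤y , y≤len) refl =
    cong (_∸ x) (row-addCell-other κ y0 y (λ { refl → NP.<-irrefl refl x≤row }) 1≤y y≤len)
    , trans (cong (_∸ y) (conj-addCell-same κ y0 1≤y0)) (NP.+-∸-assoc 1 (≤row⇒≤conj κ p y x 1≤y 1≤x x≤row))

  Removable⇒positive : ∀ l y → Removable l y → 1 ≤ y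
  Removable⇒positive (a ∷ l) (suc y) _ = s≤s z≤n

  uu-antitone : ∀ l → Partition l → ∀ i j → 1 ≤ i → i ≤ j → uu l j ≤ uu l i
  uu-antitone l p i j 1≤i i≤j = subst (λ z → uu l z ≤ uu l i) (NP.m+[n∸m]≡n i≤j) (go (j ∸ i))
    where
    go : ∀ k → uu l (i + k) ≤ uu l i
    go zero    = NP.≤-reflexive (cong (uu l) (NP.+-identityʳ i))
    go (suc k) = NP.≤-trans (NP.≤-reflexive (cong (uu l) (NP.+-suc i k)))
      (NP.≤-trans (at-suc≤at (us l) (us-StrictlyDecreasing l p) (i + k) (NP.≤-trans 1≤i (NP.m≤m+n i k))) (go k))

module IntegerSteps where
  open import Data.Nat as ℕ using (ℕ; suc)
  import Data.Nat.Properties as NP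
  open import Data.Integer as ℤ using (ℤ; +_)
  open import Relation.Binary.PropositionalEquality
  import Data.Integer.Solver as ℤSolver
  open ℤSolver.+-*-Solver using (solve; _:+_; _:-_; :-_; _:=_; con)

  +n+1 : ∀ n → + n ℤ.+ + 1 ≡ + suc n
  +n+1 n = cong +_ (NP.+-comm n 1)

  -n-1 : ∀ n → ℤ.- (+ n) ℤ.- + 1 ≡ ℤ.- (+ suc n)
  -n-1 n = solve 1 (λ n → (:- n) :- con (+ 1) := :- (con (+ 1) :+ n)) refl (+ n)

  -[1+n]+1 : ∀ n → ℤ.- (+ suc n) ℤ.+ + 1 ≡ ℤ.- (+ n)
  -[1+n]+1 n = solve 1 (λ n → (:- (con (+ 1) :+ n)) :+ con (+ 1) := :- n) refl (+ n)

  [m+n]-m : ∀ m n → + (m ℕ.+ n) ℤ.- + m ≡ + n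
  [m+n]-m m n = solve 2 (λ m n → (m :+ n) :- m := n) refl (+ m) (+ n)

  [n+m]-m : ∀ n m → + (n ℕ.+ m) ℤ.- + m ≡ + n
  [n+m]-m n m = solve 2 (λ n m → (n :+ m) :- m := n) refl (+ n) (+ m)

  [1+m+n]-m : ∀ m n → + (suc m ℕ.+ n) ℤ.- + m ≡ + suc n
  [1+m+n]-m m n = solve 2 (λ m n → (con (+ 1) :+ m :+ n) :- m := con (+ 1) :+ n) refl (+ m) (+ n)

  m-[m+n] : ∀ m n → + m ℤ.- + (m ℕ.+ n) ≡ ℤ.- (+ n)
  m-[m+n] m n = solve 2 (λ m n → m :- (m :+ n) := :- n) refl (+ m) (+ n)

  m-[n+1+m] : ∀ m n → + m ℤ.- + (n ℕ.+ suc m) ≡ ℤ.- (+ suc n)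
  m-[n+1+m] m n = solve 2 (λ m n → m :- (n :+ (con (+ 1) :+ m)) := :- (con (+ 1) :+ n)) refl (+ m) (+ n)

  second-difference : ∀ x y z b c → x ≡ y ℕ.+ b → y ≡ z ℕ.+ c → (+ x ℤ.- + y) ℤ.- (+ y ℤ.- + z) ≡ + b ℤ.- + c
  second-difference _ _ z b c refl refl =
    solve 3 (λ z b c → ((z :+ c :+ b) :- (z :+ c)) :- ((z :+ c) :- z) := b :- c) refl (+ z) (+ b) (+ c)

  second-difference′ : ∀ x y z b c → x ≡ y ℕ.+ b → y ≡ z ℕ.+ c → (+ y ℤ.- + z) ℤ.- (+ x ℤ.- + y) ≡ + c ℤ.- + b
  second-difference′ _ _ z b c refl refl =
    solve 3 (λ z b c → ((z :+ c) :- z) :- ((z :+ c :+ b) :- (z :+ c)) := c :- b) refl (+ z) (+ b) (+ c)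

module InvertedBrackets where
  open import Defs
  open TotalInverse
  open YoungDiagrams
  open IntegerSteps
  open import Data.Nat as ℕ using (ℕ; suc; _+_; _∸_; z≤n; s≤s)
  import Data.Nat.Properties as NP
  open import Data.Nat.Tactic.RingSolver using (solve-∀)
  open import Data.Integer as ℤ using (ℤ; +_)
  open import Data.Rational as ℚ using (ℚ; 0ℚ; 1ℚ; _*_; -_; _-_)
  import Data.Rational.Properties as ℚP
  open import Data.Rational.Solver using (module +-*-Solver)
  open import Data.List using (List; []; _∷_; length; map)
  open import Data.List.Relation.Unary.All as All using (All; []; _∷_)
  open import Data.Product using (_×_; _,_)
  open import Relation.Binary.PropositionalEquality

  open +-*-Solver

  prod-scale : ∀ {A : Set} (f g : A → ℚ) k xs → All (λ c → f c ≡ k * g c) xs →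
               prod (map f xs) ≡ pow k (length xs) * prod (map g xs)
  prod-scale f g k [] [] = sym (ℚP.*-identityˡ 1ℚ)
  prod-scale f g k (x ∷ xs) (e ∷ es) = trans (cong₂ _*_ e (prod-scale f g k xs es))
    (solve 4 (λ k g P G → (k :* g) :* (P :* G) := (k :* P) :* (g :* G)) refl k (g x) (pow k (length xs)) (prod (map g xs)))

  CellFactor : Set
  CellFactor = ℚ → ℚ → ℕ → ℕ → ℕ → ℕ → ℚ

  -- The factors of α and ᾱ for a cell with arm and leg a, ℓ in κ and a′, ℓ′ in ρ.
  legShiftedRatio armShiftedRatio : CellFactor
  legShiftedRatio Q T a l a′ l′ = br Q T (+ a) (+ suc l) ÷' br Q T (+ a′) (+ suc l′)
  armShiftedRatio Q T a l a′ l′ = br Q T (+ suc a) (+ l) ÷' br Q T (+ suc a′) (+ l′)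

  onCell : CellFactor → ℚ → ℚ → List ℕ → ℕ → Cell → ℚ
  onCell f Q T κ y0 c = f Q T (arm κ c) (leg κ c) (arm (addCell κ y0) c) (leg (addCell κ y0) c)

  module Inversion (q t : ℚ) (q≢0 : q ≢ 0ℚ) (t≢0 : t ≢ 0ℚ) where

    q⁻¹ t⁻¹ : ℚ
    q⁻¹ = inv q
    t⁻¹ = inv t

    mono : ℕ → ℕ → ℚ
    mono a b = pow q a * pow t b

    mono-≢0 : ∀ a b → mono a b ≢ 0ℚ
    mono-≢0 a b = *-≢0 _ _ (pow-≢0 q a q≢0) (pow-≢0 t b t≢0)

    mono-* : ∀ a b c d → mono a b * mono c d ≡ mono (a + c) (b + d)
    mono-* a b c d = begin
      (pow q a * pow t b) * (pow q c * pow t d)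
        ≡⟨ solve 4 (λ x y z w → (x :* y) :* (z :* w) := (x :* z) :* (y :* w)) refl (pow q a) (pow t b) (pow q c) (pow t d) ⟩
      (pow q a * pow q c) * (pow t b * pow t d)
        ≡⟨ sym (cong₂ _*_ (pow-+ q a c) (pow-+ t b d)) ⟩
      pow q (a + c) * pow t (b + d) ∎
      where open ≡-Reasoning

    monoRatio : ℕ → ℕ → ℕ → ℕ → ℚ
    monoRatio a b c d = mono a b * inv (mono c d)

    monoRatio-* : ∀ a b c d a′ b′ c′ d′ →
      monoRatio a b c d * monoRatio a′ b′ c′ d′ ≡ monoRatio (a + a′) (b + b′) (c + c′) (d + d′)
    monoRatio-* a b c d a′ b′ c′ d′ = begin
      (mono a b * inv (mono c d)) * (mono a′ b′ * inv (mono c′ d′))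
        ≡⟨ solve 4 (λ x y z w → (x :* y) :* (z :* w) := (x :* z) :* (y :* w)) refl (mono a b) (inv (mono c d)) (mono a′ b′) (inv (mono c′ d′)) ⟩
      (mono a b * mono a′ b′) * (inv (mono c d) * inv (mono c′ d′))
        ≡⟨ cong₂ _*_ (mono-* a b a′ b′) (sym (inv-distrib-* (mono c d) (mono c′ d′))) ⟩
      mono (a + a′) (b + b′) * inv (mono c d * mono c′ d′)
        ≡⟨ cong (λ m → mono (a + a′) (b + b′) * inv m) (mono-* c d c′ d′) ⟩
      monoRatio (a + a′) (b + b′) (c + c′) (d + d′) ∎
      where open ≡-Reasoning

    monoRatio-inv : ∀ a b c d → inv (monoRatio a b c d) ≡ monoRatio c d a b
    monoRatio-inv a b c d = begin
      inv (mono a b * inv (mono c d))        ≡⟨ inv-distrib-* (mono a b) (inv (mono c d)) ⟩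
      inv (mono a b) * inv (inv (mono c d))  ≡⟨ cong (inv (mono a b) *_) (inv-involutive (mono c d)) ⟩
      inv (mono a b) * mono c d              ≡⟨ ℚP.*-comm (inv (mono a b)) (mono c d) ⟩
      monoRatio c d a b                      ∎
      where open ≡-Reasoning

    monoRatio-cancel : ∀ a b c d k m → monoRatio (a + k) (b + m) (c + k) (d + m) ≡ monoRatio a b c d
    monoRatio-cancel a b c d k m = begin
      monoRatio (a + k) (b + m) (c + k) (d + m)
        ≡⟨ sym (monoRatio-* a b c d k m k m) ⟩
      monoRatio a b c d * monoRatio k m k m
        ≡⟨ cong (monoRatio a b c d *_) (inv-inverseʳ (mono k m) (mono-≢0 k m)) ⟩
      monoRatio a b c d * 1ℚ
        ≡⟨ ℚP.*-identityʳ _ ⟩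
      monoRatio a b c d ∎
      where open ≡-Reasoning

    monoRatio-cong : ∀ a b c d a′ b′ c′ d′ → a + c′ ≡ a′ + c → b + d′ ≡ b′ + d →
                     monoRatio a b c d ≡ monoRatio a′ b′ c′ d′
    monoRatio-cong a b c d a′ b′ c′ d′ eq₁ eq₂ = begin
      monoRatio a b c d
        ≡⟨ sym (monoRatio-cancel a b c d c′ d′) ⟩
      monoRatio (a + c′) (b + d′) (c + c′) (d + d′)
        ≡⟨ cong₂ (λ x y → monoRatio x y (c + c′) (d + d′)) eq₁ eq₂ ⟩
      monoRatio (a′ + c) (b′ + d) (c + c′) (d + d′)
        ≡⟨ cong₂ (monoRatio (a′ + c) (b′ + d)) (NP.+-comm c c′) (NP.+-comm d d′) ⟩
      monoRatio (a′ + c) (b′ + d) (c′ + c) (d′ + d)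
        ≡⟨ monoRatio-cancel a′ b′ c′ d′ c d ⟩
      monoRatio a′ b′ c′ d′ ∎
      where open ≡-Reasoning

    mono≡monoRatio : ∀ a b → mono a b ≡ monoRatio a b 0 0
    mono≡monoRatio a b = sym (ℚP.*-identityʳ (mono a b))

    inv-mono : ∀ a b → inv (mono a b) ≡ monoRatio 0 0 a b
    inv-mono a b = sym (ℚP.*-identityˡ (inv (mono a b)))

    br-inv : ∀ a b → br q⁻¹ t⁻¹ (+ a) (+ b) ≡ - inv (mono a b) * br q t (+ a) (+ b)
    br-inv a b = begin
      1ℚ - pow q⁻¹ a * pow t⁻¹ b           ≡⟨ cong₂ (λ x y → 1ℚ - x * y) (pow-inv q a) (pow-inv t b) ⟩
      1ℚ - inv (pow q a) * inv (pow t b)   ≡⟨ cong (λ z → 1ℚ - z) (sym (inv-distrib-* (pow q a) (pow t b))) ⟩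
      1ℚ - x                               ≡⟨ cong (_- x) (sym (trans (ℚP.*-comm x m) (inv-inverseʳ m (mono-≢0 a b)))) ⟩
      x * m - x                            ≡⟨ solve 2 (λ x m → x :* m :- x := (:- x) :* (con 1ℚ :- m)) refl x m ⟩
      - x * (1ℚ - m)                       ∎
      where open ≡-Reasoning
            m = mono a b
            x = inv m

    br-inv-neg : ∀ i j → br q⁻¹ t⁻¹ (ℤ.- i) (ℤ.- j) ≡ br q t i j
    br-inv-neg i j = cong₂ (λ x y → 1ℚ - x * y) (zpow-inv-neg q i) (zpow-inv-neg t j)

    br-ratio-inv : ∀ a b a′ b′ → br q⁻¹ t⁻¹ (+ a) (+ b) ÷' br q⁻¹ t⁻¹ (+ a′) (+ b′)
                 ≡ (inv (mono a b) * mono a′ b′) * (br q t (+ a) (+ b) ÷' br q t (+ a′) (+ b′))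
    br-ratio-inv a b a′ b′ = begin
      br q⁻¹ t⁻¹ (+ a) (+ b) ÷' br q⁻¹ t⁻¹ (+ a′) (+ b′)
        ≡⟨ cong₂ _÷'_ (br-inv a b) (br-inv a′ b′) ⟩
      (- inv m * X) ÷' (- inv m′ * Y)
        ≡⟨ ÷'-scale (- inv m) (- inv m′) X Y ⟩
      (- inv m * inv (- inv m′)) * (X ÷' Y)
        ≡⟨ cong (λ z → (- inv m * z) * (X ÷' Y)) (trans (inv-neg (inv m′)) (cong -_ (inv-involutive m′))) ⟩
      (- inv m * - m′) * (X ÷' Y)
        ≡⟨ cong (_* (X ÷' Y)) (solve 2 (λ x y → (:- x) :* (:- y) := x :* y) refl (inv m) m′) ⟩
      (inv m * m′) * (X ÷' Y) ∎
      where open ≡-Reasoning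
            m = mono a b
            m′ = mono a′ b′
            X = br q t (+ a) (+ b)
            Y = br q t (+ a′) (+ b′)

    inv-mono-scale : ∀ k a b → inv (mono a b) * (k * mono a b) ≡ k
    inv-mono-scale k a b = trans (ℚP.*-comm (inv (mono a b)) (k * mono a b)) (*-inv-cancel _ _ k (mono-≢0 a b) refl)

    br-ratio-inv-arm : ∀ a b → br q⁻¹ t⁻¹ (+ a) (+ b) ÷' br q⁻¹ t⁻¹ (+ suc a) (+ b)
                     ≡ q * (br q t (+ a) (+ b) ÷' br q t (+ suc a) (+ b))
    br-ratio-inv-arm a b = trans (br-ratio-inv a b (suc a) b)
      (cong (_* (br q t (+ a) (+ b) ÷' br q t (+ suc a) (+ b)))
        (trans (cong (inv (mono a b) *_) (ℚP.*-assoc q (pow q a) (pow t b))) (inv-mono-scale q a b)))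

    br-ratio-inv-leg : ∀ a b → br q⁻¹ t⁻¹ (+ a) (+ b) ÷' br q⁻¹ t⁻¹ (+ a) (+ suc b)
                     ≡ t * (br q t (+ a) (+ b) ÷' br q t (+ a) (+ suc b))
    br-ratio-inv-leg a b = trans (br-ratio-inv a b a (suc b))
      (cong (_* (br q t (+ a) (+ b) ÷' br q t (+ a) (+ suc b))) (trans (cong (inv (mono a b) *_)
        (solve 3 (λ t x y → x :* (t :* y) := t :* (x :* y)) refl t (pow q a) (pow t b))) (inv-mono-scale t a b)))

    ArmScaling LegScaling : CellFactor → Set
    ArmScaling f = ∀ a l → f q⁻¹ t⁻¹ a l (suc a) l ≡ q * f q t a l (suc a) l
    LegScaling f = ∀ a l → f q⁻¹ t⁻¹ a l a (suc l) ≡ t * f q t a l a (suc l)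

    legShiftedRatio-arm : ArmScaling legShiftedRatio
    legShiftedRatio-arm a l = br-ratio-inv-arm a (suc l)

    armShiftedRatio-arm : ArmScaling armShiftedRatio
    armShiftedRatio-arm a l = br-ratio-inv-arm (suc a) l

    legShiftedRatio-leg : LegScaling legShiftedRatio
    legShiftedRatio-leg a l = br-ratio-inv-leg a (suc l)

    armShiftedRatio-leg : LegScaling armShiftedRatio
    armShiftedRatio-leg a l = br-ratio-inv-leg (suc a) l

    module _ (κ : List ℕ) (y0 : ℕ) (p : Partition κ) (addable : Addable κ y0) where

      prod-Rset-inv : ∀ f → ArmScaling f →
        prod (map (onCell f q⁻¹ t⁻¹ κ y0) (Rset κ y0)) ≡ pow q (row κ y0) * prod (map (onCell f q t κ y0) (Rset κ y0))
      prod-Rset-inv f scaling = trans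
        (prod-scale _ _ q (Rset κ y0)
          (All.map (λ { {c} (c∈κ , same-row) → cell-scaling c (Rset-arm-leg κ y0 c c∈κ same-row) }) (Rset-InDiagram κ y0)))
        (cong (λ n → pow q n * prod (map (onCell f q t κ y0) (Rset κ y0))) (length-Rset κ y0 (Addable⇒positive κ y0 addable)))
        where
        cell-scaling : ∀ c → arm (addCell κ y0) c ≡ suc (arm κ c) × leg (addCell κ y0) c ≡ leg κ c →
                       onCell f q⁻¹ t⁻¹ κ y0 c ≡ q * onCell f q t κ y0 c
        cell-scaling c (a′≡ , l′≡) rewrite a′≡ | l′≡ = scaling (arm κ c) (leg κ c)

      prod-Cset-inv : ∀ f → LegScaling f →
        prod (map (onCell f q⁻¹ t⁻¹ κ y0) (Cset κ y0)) ≡ pow t (y0 ∸ 1) * prod (map (onCell f q t κ y0) (Cset κ y0))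
      prod-Cset-inv f scaling = trans
        (prod-scale _ _ t (Cset κ y0)
          (All.map (λ { {c} (c∈κ , same-col) → cell-scaling c (Cset-arm-leg κ y0 c p 1≤y0 c∈κ same-col) }) (Cset-InDiagram κ y0)))
        (cong (λ n → pow t n * prod (map (onCell f q t κ y0) (Cset κ y0)))
              (trans (length-column κ (suc (row κ y0)) (s≤s z≤n)) (conj-addCell-column κ y0 p addable)))
        where
        1≤y0 = Addable⇒positive κ y0 addable
        cell-scaling : ∀ c → arm (addCell κ y0) c ≡ arm κ c × leg (addCell κ y0) c ≡ suc (leg κ c) →
                       onCell f q⁻¹ t⁻¹ κ y0 c ≡ t * onCell f q t κ y0 c
        cell-scaling c (a′≡ , l′≡) rewrite a′≡ | l′≡ = scaling (arm κ c) (leg κ c)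

      private
        regroup : ∀ a b X Y → (a * X) * (b * Y) ≡ (a * b) * (X * Y)
        regroup a b X Y = solve 4 (λ a b X Y → (a :* X) :* (b :* Y) := (a :* b) :* (X :* Y)) refl a b X Y

      alphaAdd-inv : alphaAdd q⁻¹ t⁻¹ κ y0 ≡ mono (row κ y0) (y0 ∸ 1) * alphaAdd q t κ y0
      alphaAdd-inv = trans (cong₂ _*_ (prod-Rset-inv legShiftedRatio legShiftedRatio-arm) (prod-Cset-inv armShiftedRatio armShiftedRatio-leg))
                           (regroup (pow q (row κ y0)) (pow t (y0 ∸ 1)) _ _)

      alphaBarAdd-inv : alphaBarAdd q⁻¹ t⁻¹ κ y0 ≡ mono (row κ y0) (y0 ∸ 1) * alphaBarAdd q t κ y0
      alphaBarAdd-inv = trans (cong₂ _*_ (prod-Rset-inv armShiftedRatio armShiftedRatio-arm) (prod-Cset-inv legShiftedRatio legShiftedRatio-leg))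
                              (regroup (pow q (row κ y0)) (pow t (y0 ∸ 1)) _ _)

    pow-t⁻¹ : ∀ n → pow t⁻¹ n ≡ monoRatio 0 0 0 n
    pow-t⁻¹ n = begin
      pow t⁻¹ n               ≡⟨ pow-inv t n ⟩
      inv (pow t n)           ≡⟨ cong inv (sym (ℚP.*-identityˡ (pow t n))) ⟩
      inv (mono 0 n)          ≡⟨ inv-mono 0 n ⟩
      monoRatio 0 0 0 n       ∎
      where open ≡-Reasoning

    coefficient-quotient : ∀ a b c d a′ b′ c′ d′ →
      (inv (mono a b) * inv (mono c d)) * inv (inv (mono a′ b′) * inv (mono c′ d′))
        ≡ monoRatio (a′ + c′) (b′ + d′) (a + c) (b + d)
    coefficient-quotient a b c d a′ b′ c′ d′ = begin
      (inv (mono a b) * inv (mono c d)) * inv (inv (mono a′ b′) * inv (mono c′ d′))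
        ≡⟨ cong₂ (λ x y → x * inv y) (cong₂ _*_ (inv-mono a b) (inv-mono c d)) (cong₂ _*_ (inv-mono a′ b′) (inv-mono c′ d′)) ⟩
      (monoRatio 0 0 a b * monoRatio 0 0 c d) * inv (monoRatio 0 0 a′ b′ * monoRatio 0 0 c′ d′)
        ≡⟨ cong₂ (λ x y → x * inv y) (monoRatio-* 0 0 a b 0 0 c d) (monoRatio-* 0 0 a′ b′ 0 0 c′ d′) ⟩
      monoRatio 0 0 (a + c) (b + d) * inv (monoRatio 0 0 (a′ + c′) (b′ + d′))
        ≡⟨ cong (monoRatio 0 0 (a + c) (b + d) *_) (monoRatio-inv 0 0 (a′ + c′) (b′ + d′)) ⟩
      monoRatio 0 0 (a + c) (b + d) * monoRatio (a′ + c′) (b′ + d′) 0 0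
        ≡⟨ monoRatio-* 0 0 (a + c) (b + d) (a′ + c′) (b′ + d′) 0 0 ⟩
      monoRatio (a′ + c′) (b′ + d′) (a + c + 0) (b + d + 0)
        ≡⟨ cong₂ (monoRatio (a′ + c′) (b′ + d′)) (NP.+-identityʳ (a + c)) (NP.+-identityʳ (b + d)) ⟩
      monoRatio (a′ + c′) (b′ + d′) (a + c) (b + d) ∎
      where open ≡-Reasoning

    private
      D⁻¹ D : ℚ
      D⁻¹ = br q⁻¹ t⁻¹ (+ 1) (+ 0) * br q⁻¹ t⁻¹ (+ 0) (+ 1)
      D = br q t (+ 0) (+ 1) * br q t (+ 1) (+ 0)

      D⁻¹≡ : D⁻¹ ≡ (inv (mono 1 0) * inv (mono 0 1)) * D
      D⁻¹≡ = trans (cong₂ _*_ (br-inv 1 0) (br-inv 0 1)) (neg-*-neg (inv (mono 1 0)) (inv (mono 0 1)) (br q t (+ 1) (+ 0)) (br q t (+ 0) (+ 1)))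

    gammaNLM-inv-≤ : ∀ ν l μ h V → n'Diff l μ ℤ.- n'Diff ν l ≡ + h → nDiff ν l ℤ.- nDiff l μ ≡ + suc V →
      gammaNLM q⁻¹ t⁻¹ ν l μ ≡ monoRatio 1 1 (h + suc h) (suc V + V) * ((br q t (+ suc h) (+ V) * br q t (+ h) (+ suc V)) ÷' D)
    gammaNLM-inv-≤ ν l μ h V M≡ N≡ = begin
      gammaNLM q⁻¹ t⁻¹ ν l μ
        ≡⟨ cong₂ (λ M N → (br q⁻¹ t⁻¹ M N * br q⁻¹ t⁻¹ (M ℤ.+ + 1) (N ℤ.- + 1)) ÷' D⁻¹) M≡ N≡ ⟩
      (br q⁻¹ t⁻¹ (+ h) (+ suc V) * br q⁻¹ t⁻¹ (+ h ℤ.+ + 1) (+ V)) ÷' D⁻¹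
        ≡⟨ cong₂ (λ M D′ → (br q⁻¹ t⁻¹ (+ h) (+ suc V) * br q⁻¹ t⁻¹ M (+ V)) ÷' D′) (+n+1 h) D⁻¹≡ ⟩
      (br q⁻¹ t⁻¹ (+ h) (+ suc V) * br q⁻¹ t⁻¹ (+ suc h) (+ V)) ÷' (y * D)
        ≡⟨ cong (_÷' (y * D)) (trans (cong₂ _*_ (br-inv h (suc V)) (br-inv (suc h) V)) (neg-*-neg x₁ x₂ X₁ X₂)) ⟩
      (x * (X₂ * X₁)) ÷' (y * D)
        ≡⟨ ÷'-scale x y (X₂ * X₁) D ⟩
      (x * inv y) * ((X₂ * X₁) ÷' D)
        ≡⟨ cong (_* ((X₂ * X₁) ÷' D)) (coefficient-quotient h (suc V) (suc h) V 1 0 0 1) ⟩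
      monoRatio 1 1 (h + suc h) (suc V + V) * ((X₂ * X₁) ÷' D) ∎
      where
      open ≡-Reasoning
      x₁ = inv (mono h (suc V))
      x₂ = inv (mono (suc h) V)
      x = x₁ * x₂
      y = inv (mono 1 0) * inv (mono 0 1)
      X₁ = br q t (+ h) (+ suc V)
      X₂ = br q t (+ suc h) (+ V)

    gammaNLM-inv-> : ∀ ν l μ H V₀ → n'Diff l μ ℤ.- n'Diff ν l ≡ ℤ.- (+ suc H) → nDiff ν l ℤ.- nDiff l μ ≡ ℤ.- (+ V₀) →
      gammaNLM q⁻¹ t⁻¹ ν l μ ≡ monoRatio 1 1 0 0 * ((br q t (+ H) (+ suc V₀) * br q t (+ suc H) (+ V₀)) ÷' D)
    gammaNLM-inv-> ν l μ H V₀ M≡ N≡ = begin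
      gammaNLM q⁻¹ t⁻¹ ν l μ
        ≡⟨ cong₂ (λ M N → (br q⁻¹ t⁻¹ M N * br q⁻¹ t⁻¹ (M ℤ.+ + 1) (N ℤ.- + 1)) ÷' D⁻¹) M≡ N≡ ⟩
      (br q⁻¹ t⁻¹ (ℤ.- (+ suc H)) (ℤ.- (+ V₀)) * br q⁻¹ t⁻¹ (ℤ.- (+ suc H) ℤ.+ + 1) (ℤ.- (+ V₀) ℤ.- + 1)) ÷' D⁻¹
        ≡⟨ cong₂ (λ M N → (br q⁻¹ t⁻¹ (ℤ.- (+ suc H)) (ℤ.- (+ V₀)) * br q⁻¹ t⁻¹ M N) ÷' D⁻¹) (-[1+n]+1 H) (-n-1 V₀) ⟩
      (br q⁻¹ t⁻¹ (ℤ.- (+ suc H)) (ℤ.- (+ V₀)) * br q⁻¹ t⁻¹ (ℤ.- (+ H)) (ℤ.- (+ suc V₀))) ÷' D⁻¹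
        ≡⟨ cong₂ _÷'_ (cong₂ _*_ (br-inv-neg (+ suc H) (+ V₀)) (br-inv-neg (+ H) (+ suc V₀))) D⁻¹≡ ⟩
      (X₁ * X₂) ÷' (y * D)
        ≡⟨ cong (_÷' (y * D)) (trans (ℚP.*-comm X₁ X₂) (sym (ℚP.*-identityˡ (X₂ * X₁)))) ⟩
      (x * (X₂ * X₁)) ÷' (y * D)
        ≡⟨ ÷'-scale x y (X₂ * X₁) D ⟩
      (x * inv y) * ((X₂ * X₁) ÷' D)
        ≡⟨ cong (_* ((X₂ * X₁) ÷' D)) (coefficient-quotient 0 0 0 0 1 0 0 1) ⟩
      monoRatio 1 1 0 0 * ((X₂ * X₁) ÷' D) ∎
      where
      open ≡-Reasoning
      x = inv (mono 0 0) * inv (mono 0 0)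
      y = inv (mono 1 0) * inv (mono 0 1)
      X₁ = br q t (+ suc H) (+ V₀)
      X₂ = br q t (+ H) (+ suc V₀)

    monoRatio-combine : ∀ a₁ b₁ c₁ d₁ a₂ b₂ a₃ b₃ a₄ b₄ c₄ d₄ →
      monoRatio a₁ b₁ c₁ d₁ * mono a₂ b₂ * inv (mono a₃ b₃) * inv (monoRatio a₄ b₄ c₄ d₄)
        ≡ monoRatio (a₁ + a₂ + c₄) (b₁ + b₂ + d₄) (c₁ + a₃ + a₄) (d₁ + b₃ + b₄)
    monoRatio-combine a₁ b₁ c₁ d₁ a₂ b₂ a₃ b₃ a₄ b₄ c₄ d₄ = begin
      monoRatio a₁ b₁ c₁ d₁ * mono a₂ b₂ * inv (mono a₃ b₃) * inv (monoRatio a₄ b₄ c₄ d₄)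
        ≡⟨ cong₂ _*_ (cong₂ _*_ (cong (monoRatio a₁ b₁ c₁ d₁ *_) (mono≡monoRatio a₂ b₂)) (inv-mono a₃ b₃)) (monoRatio-inv a₄ b₄ c₄ d₄) ⟩
      monoRatio a₁ b₁ c₁ d₁ * monoRatio a₂ b₂ 0 0 * monoRatio 0 0 a₃ b₃ * monoRatio c₄ d₄ a₄ b₄
        ≡⟨ cong (λ x → x * monoRatio 0 0 a₃ b₃ * monoRatio c₄ d₄ a₄ b₄) (monoRatio-* a₁ b₁ c₁ d₁ a₂ b₂ 0 0) ⟩
      monoRatio (a₁ + a₂) (b₁ + b₂) (c₁ + 0) (d₁ + 0) * monoRatio 0 0 a₃ b₃ * monoRatio c₄ d₄ a₄ b₄
        ≡⟨ cong (_* monoRatio c₄ d₄ a₄ b₄) (monoRatio-* (a₁ + a₂) (b₁ + b₂) (c₁ + 0) (d₁ + 0) 0 0 a₃ b₃) ⟩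
      monoRatio (a₁ + a₂ + 0) (b₁ + b₂ + 0) (c₁ + 0 + a₃) (d₁ + 0 + b₃) * monoRatio c₄ d₄ a₄ b₄
        ≡⟨ monoRatio-* (a₁ + a₂ + 0) (b₁ + b₂ + 0) (c₁ + 0 + a₃) (d₁ + 0 + b₃) c₄ d₄ a₄ b₄ ⟩
      monoRatio (a₁ + a₂ + 0 + c₄) (b₁ + b₂ + 0 + d₄) (c₁ + 0 + a₃ + a₄) (d₁ + 0 + b₃ + b₄)
        ≡⟨ monoRatio-cong (a₁ + a₂ + 0 + c₄) (b₁ + b₂ + 0 + d₄) (c₁ + 0 + a₃ + a₄) (d₁ + 0 + b₃ + b₄)
                          (a₁ + a₂ + c₄) (b₁ + b₂ + d₄) (c₁ + a₃ + a₄) (d₁ + b₃ + b₄)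
                          (exponents a₁ a₂ c₄ c₁ a₃ a₄) (exponents b₁ b₂ d₄ d₁ b₃ b₄) ⟩
      monoRatio (a₁ + a₂ + c₄) (b₁ + b₂ + d₄) (c₁ + a₃ + a₄) (d₁ + b₃ + b₄) ∎
      where
      open ≡-Reasoning
      exponents : ∀ a₁ a₂ c₄ c₁ a₃ a₄ → a₁ + a₂ + 0 + c₄ + (c₁ + a₃ + a₄) ≡ a₁ + a₂ + c₄ + (c₁ + 0 + a₃ + a₄)
      exponents = solve-∀

    scalar-≤ : ∀ u′ w V h →
      pow t⁻¹ V * mono u′ (suc w + V) * inv (mono (h + u′) w) * inv (monoRatio 1 1 (h + suc h) (suc V + V))
        ≡ mono h (suc (V + (V + 0)))
    scalar-≤ u′ w V h = begin
      pow t⁻¹ V * mono u′ (suc w + V) * inv (mono (h + u′) w) * inv (monoRatio 1 1 (h + suc h) (suc V + V))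
        ≡⟨ cong (λ x → x * mono u′ (suc w + V) * inv (mono (h + u′) w) * inv (monoRatio 1 1 (h + suc h) (suc V + V))) (pow-t⁻¹ V) ⟩
      monoRatio 0 0 0 V * mono u′ (suc w + V) * inv (mono (h + u′) w) * inv (monoRatio 1 1 (h + suc h) (suc V + V))
        ≡⟨ monoRatio-combine 0 0 0 V u′ (suc w + V) (h + u′) w 1 1 (h + suc h) (suc V + V) ⟩
      monoRatio (u′ + (h + suc h)) (suc w + V + (suc V + V)) (h + u′ + 1) (V + w + 1)
        ≡⟨ monoRatio-cong _ _ _ _ h (suc (V + (V + 0))) 0 0 (q-exponents u′ h) (t-exponents w V) ⟩
      monoRatio h (suc (V + (V + 0))) 0 0
        ≡⟨ sym (mono≡monoRatio h (suc (V + (V + 0)))) ⟩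
      mono h (suc (V + (V + 0))) ∎
      where
      open ≡-Reasoning
      q-exponents : ∀ u′ h → u′ + (h + suc h) + 0 ≡ h + (h + u′ + 1)
      q-exponents = solve-∀
      t-exponents : ∀ w V → suc w + V + (suc V + V) + 0 ≡ suc (V + (V + 0)) + (V + w + 1)
      t-exponents = solve-∀

    scalar-> : ∀ H u₀ vS V₀ →
      pow t (suc V₀) * mono (H + suc u₀) vS * inv (mono u₀ (vS + V₀)) * inv (monoRatio 1 1 0 0) ≡ pow q H
    scalar-> H u₀ vS V₀ = begin
      pow t (suc V₀) * mono (H + suc u₀) vS * inv (mono u₀ (vS + V₀)) * inv (monoRatio 1 1 0 0)
        ≡⟨ cong (λ x → x * mono (H + suc u₀) vS * inv (mono u₀ (vS + V₀)) * inv (monoRatio 1 1 0 0))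
                (trans (sym (ℚP.*-identityˡ (pow t (suc V₀)))) (mono≡monoRatio 0 (suc V₀))) ⟩
      monoRatio 0 (suc V₀) 0 0 * mono (H + suc u₀) vS * inv (mono u₀ (vS + V₀)) * inv (monoRatio 1 1 0 0)
        ≡⟨ monoRatio-combine 0 (suc V₀) 0 0 (H + suc u₀) vS u₀ (vS + V₀) 1 1 0 0 ⟩
      monoRatio (H + suc u₀ + 0) (suc V₀ + vS + 0) (u₀ + 1) (vS + V₀ + 1)
        ≡⟨ monoRatio-cong _ _ _ _ H 0 0 0 (q-exponents H u₀) (t-exponents V₀ vS) ⟩
      monoRatio H 0 0 0
        ≡⟨ sym (mono≡monoRatio H 0) ⟩
      pow q H * 1ℚ
        ≡⟨ ℚP.*-identityʳ (pow q H) ⟩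
      pow q H ∎
      where
      open ≡-Reasoning
      q-exponents : ∀ H u₀ → H + suc u₀ + 0 + 0 ≡ H + (u₀ + 1)
      q-exponents = solve-∀
      t-exponents : ∀ V₀ vS → suc V₀ + vS + 0 + 0 ≡ vS + V₀ + 1
      t-exponents = solve-∀

open import Defs
open import Data.Nat as ℕ using (ℕ; zero; suc; _+_; _∸_; _≤_; _<_; z≤n; s≤s)
import Data.Nat.Properties as NP
open import Data.Integer as ℤ using (ℤ; +_; -[1+_])
open import Data.Rational as ℚ using (ℚ; 0ℚ; 1ℚ; _*_)
import Data.Rational.Properties as ℚP
open import Data.Rational.Solver using (module +-*-Solver)
open import Data.List using (List)
open import Data.Product using (Σ; _×_; _,_; proj₁; proj₂)
open import Data.Empty using (⊥-elim)
open import Relation.Nullary using (¬_; yes; no; Dec)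
open import Relation.Binary.PropositionalEquality

open +-*-Solver
open TotalInverse
open YoungDiagrams
open IntegerSteps
open InvertedBrackets

gammaP-≤ : ∀ q t l r s → r ≤ s → gammaP q t l r s ≡
  (br q t (+ hs l r s) (+ vs l (suc r) s) * br q t (+ hs l r s ℤ.- + 1) (+ vs l (suc r) s ℤ.+ + 1)) ÷' (br q t (+ 0) (+ 1) * br q t (+ 1) (+ 0))
gammaP-≤ q t l r s r≤s with r ℕ.≤? s
... | yes _  = refl
... | no r≰s = ⊥-elim (r≰s r≤s)

gammaP-> : ∀ q t l r s → ¬ r ≤ s → gammaP q t l r s ≡
  (br q t (+ hs l (suc s) (r ∸ 1)) (+ vs l (suc s) r) * br q t (+ hs l (suc s) (r ∸ 1) ℤ.+ + 1) (+ vs l (suc s) r ℤ.- + 1))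
    ÷' (br q t (+ 0) (+ 1) * br q t (+ 1) (+ 0))
gammaP-> q t l r s r≰s with r ℕ.≤? s
... | yes r≤s = ⊥-elim (r≰s r≤s)
... | no _    = refl

tauCol-≤ : ∀ q t l r s → r ≤ s → tauCol q t l r s ≡ zpow q (-[1+ 0 ] ℤ.+ + hs l r s) * zpow t (+ (1 + 2 ℕ.* vs l (suc r) s))
tauCol-≤ q t l r s r≤s with r ℕ.≤? s
... | yes _  = refl
... | no r≰s = ⊥-elim (r≰s r≤s)

tauCol-> : ∀ q t l r s → ¬ r ≤ s → tauCol q t l r s ≡ zpow q (+ hs l (suc s) (r ∸ 1))
tauCol-> q t l r s r≰s with r ℕ.≤? s
... | yes r≤s = ⊥-elim (r≰s r≤s)
... | no _    = refl

module ColumnFormulas (l : List ℕ) (p : Partition l) (q t : ℚ) (q≢0 : q ≢ 0ℚ) (t≢0 : t ≢ 0ℚ)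
                      (s : ℕ) (s≤d : s ≤ dd l) where
  open Inversion q t q≢0 t≢0

  vS u′ : ℕ
  vS = vs l 1 s
  u′ = uu l (suc s)

  ν : List ℕ
  ν = plusS l s

  ν-corner : row l (suc vS) ≡ u′ × Addable l (suc vS)
  ν-corner = plusS-corner l s p s≤d

  n-ν : nn ν ≡ nn l + vS
  n-ν = n-addCell l (suc vS) p (proj₂ ν-corner)

  n′-ν : nn' ν ≡ nn' l + u′
  n′-ν = trans (n′-addCell l (suc vS) (s≤s z≤n)) (cong (nn' l ℕ.+_) (proj₁ ν-corner))

  alphaS-inv : alphaS q⁻¹ t⁻¹ l s ≡ mono u′ vS * alphaS q t l s
  alphaS-inv = trans (alphaAdd-inv l (suc vS) p (proj₂ ν-corner)) (cong (λ a → mono a vS * alphaS q t l s) (proj₁ ν-corner))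

  alphaBarS-inv : alphaBarS q⁻¹ t⁻¹ l s ≡ mono u′ vS * alphaBarS q t l s
  alphaBarS-inv = trans (alphaBarAdd-inv l (suc vS) p (proj₂ ν-corner)) (cong (λ a → mono a vS * alphaBarS q t l s) (proj₁ ν-corner))

  hs-to-end : hs l (suc s) (dd l) ≡ u′
  hs-to-end = begin
    hs l (suc s) (dd l)                              ≡⟨ sym (NP.+-identityʳ _) ⟩
    hs l (suc s) (dd l) + 0                        ≡⟨ cong (hs l (suc s) (dd l) ℕ.+_) (sym (uu-beyond-dd l)) ⟩
    hs l (suc s) (dd l) + uu l (suc (dd l))        ≡⟨ hs-telescope l p (suc s) (dd l) (s≤s z≤n) (s≤s s≤d) ⟩
    u′                                               ∎
    where open ≡-Reasoning

  column-formula-0 : ∀ α′ α → α′ ≡ mono u′ vS * α → zpow t⁻¹ (nDiff ν l) * α′ ≡ zpow q (+ hs l (suc s) (dd l)) * α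
  column-formula-0 α′ α refl = begin
    zpow t⁻¹ (nDiff ν l) * (mono u′ vS * α)
      ≡⟨ cong (λ n → zpow t⁻¹ n * (mono u′ vS * α)) (trans (cong (λ n → + n ℤ.- + nn l) n-ν) ([m+n]-m (nn l) vS)) ⟩
    pow t⁻¹ vS * (mono u′ vS * α)
      ≡⟨ cong (_* (mono u′ vS * α)) (pow-inv t vS) ⟩
    inv (pow t vS) * ((pow q u′ * pow t vS) * α)
      ≡⟨ solve 4 (λ x Q T a → x :* (Q :* T :* a) := (T :* x) :* (Q :* a)) refl (inv (pow t vS)) (pow q u′) (pow t vS) α ⟩
    (pow t vS * inv (pow t vS)) * (pow q u′ * α)
      ≡⟨ cong (_* (pow q u′ * α)) (inv-inverseʳ (pow t vS) (pow-≢0 t vS t≢0)) ⟩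
    1ℚ * (pow q u′ * α)
      ≡⟨ ℚP.*-identityˡ _ ⟩
    pow q u′ * α
      ≡⟨ cong (λ n → pow q n * α) (sym hs-to-end) ⟩
    pow q (hs l (suc s) (dd l)) * α ∎
    where open ≡-Reasoning

  module Removal (r′ : ℕ) (r≤d : suc r′ ≤ dd l) where
    r vR u w : ℕ
    r = suc r′
    vR = vs l 1 r
    u = uu l r
    w = vR ∸ 1

    μ : List ℕ
    μ = minusR l r

    μ-corner : Removable l vR × row l vR ≡ u
    μ-corner = minusR-corner l r p (s≤s z≤n) r≤d

    μ-spec : RemoveCellSpec l vR
    μ-spec = removeCell-spec l vR p (proj₁ μ-corner)

    μ-partition : Partition μ
    μ-partition = proj₁ μ-spec

    μ-addable : Addable μ vR
    μ-addable = proj₁ (proj₂ μ-spec)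

    μ-restores : addCell μ vR ≡ l
    μ-restores = proj₁ (proj₂ (proj₂ μ-spec))

    μ-row : row μ vR ≡ u ∸ 1
    μ-row = trans (proj₂ (proj₂ (proj₂ μ-spec))) (cong (_∸ 1) (proj₂ μ-corner))

    suc-w : suc w ≡ vR
    suc-w = NP.suc-pred vR {{ℕ.>-nonZero (Removable⇒positive l vR (proj₁ μ-corner))}}

    n-l : nn l ≡ nn μ + w
    n-l = subst (λ κ → nn κ ≡ nn μ + w) μ-restores (n-addCell μ vR μ-partition μ-addable)

    n′-l : nn' l ≡ nn' μ + (u ∸ 1)
    n′-l = subst (λ κ → nn' κ ≡ nn' μ + (u ∸ 1)) μ-restores
                 (trans (n′-addCell μ vR (Addable⇒positive μ vR μ-addable)) (cong (nn' μ ℕ.+_) μ-row))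

    N M : ℤ
    N = nDiff ν l ℤ.- nDiff l μ
    M = n'Diff l μ ℤ.- n'Diff ν l

    N≡ : N ≡ + vS ℤ.- + w
    N≡ = second-difference (nn ν) (nn l) (nn μ) vS w n-ν n-l

    M≡ : M ≡ + (u ∸ 1) ℤ.- + u′
    M≡ = second-difference′ (nn' ν) (nn' l) (nn' μ) u′ (u ∸ 1) n′-ν n′-l

    alphaAdd-μ-inv : alphaAdd q⁻¹ t⁻¹ μ vR ≡ mono (u ∸ 1) w * alphaAdd q t μ vR
    alphaAdd-μ-inv = trans (alphaAdd-inv μ vR μ-partition μ-addable) (cong (λ a → mono a w * alphaAdd q t μ vR) μ-row)

    alphaBarAdd-μ-inv : alphaBarAdd q⁻¹ t⁻¹ μ vR ≡ mono (u ∸ 1) w * alphaBarAdd q t μ vR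
    alphaBarAdd-μ-inv = trans (alphaBarAdd-inv μ vR μ-partition μ-addable) (cong (λ a → mono a w * alphaBarAdd q t μ vR) μ-row)

    GammaScaling : Set
    GammaScaling = Σ ℚ λ c → gammaNLM q⁻¹ t⁻¹ ν l μ ≡ c * gammaP q t l r s
                           × zpow t⁻¹ (N ℤ.- + 1) * mono u′ vS * inv (mono (u ∸ 1) w) * inv c ≡ tauCol q t l r s

    gamma-scaling-≤ : r ≤ s → GammaScaling
    gamma-scaling-≤ r≤s = monoRatio 1 1 (h + suc h) (suc V + V) , γ≡ , τ≡
      where
      V H h : ℕ
      V = vs l (suc r) s
      H = hs l r s
      h = ℕ.pred H

      vS≡ : vS ≡ suc w + V
      vS≡ = trans (sym (vs-split l 1 r s (s≤s z≤n) r≤s)) (cong (_+ V) (sym suc-w))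

      H+u′≡u : H + u′ ≡ u
      H+u′≡u = hs-telescope l p r s (s≤s z≤n) (NP.m≤n⇒m≤1+n r≤s)

      u′<u : u′ < u
      u′<u = NP.≤-<-trans (uu-antitone l p (suc r) (suc s) (s≤s z≤n) (s≤s r≤s))
                          (at-suc<at (us l) (us-StrictlyDecreasing l p) r (s≤s z≤n) r≤d)

      H≡ : suc h ≡ H
      H≡ = NP.suc-pred H {{ℕ.>-nonZero (NP.+-cancelʳ-< u′ 0 H (subst (u′ <_) (sym H+u′≡u) u′<u))}}

      u∸1≡ : u ∸ 1 ≡ h + u′
      u∸1≡ = cong (_∸ 1) (trans (sym H+u′≡u) (cong (_+ u′) (sym H≡)))

      N≡+1+V : N ≡ + suc V
      N≡+1+V = trans N≡ (trans (cong (λ n → + n ℤ.- + w) vS≡) ([1+m+n]-m w V))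

      M≡+h : M ≡ + h
      M≡+h = trans M≡ (trans (cong (λ n → + n ℤ.- + u′) u∸1≡) ([n+m]-m h u′))

      γ≡ : gammaNLM q⁻¹ t⁻¹ ν l μ ≡ monoRatio 1 1 (h + suc h) (suc V + V) * gammaP q t l r s
      γ≡ = trans (gammaNLM-inv-≤ ν l μ h V M≡+h N≡+1+V)
                 (cong (monoRatio 1 1 (h + suc h) (suc V + V) *_) (sym (trans (gammaP-≤ q t l r s r≤s)
                   (cong₂ (λ H′ V′ → (br q t (+ H′) (+ V) * br q t (+ H′ ℤ.- + 1) V′) ÷' (br q t (+ 0) (+ 1) * br q t (+ 1) (+ 0)))
                          (sym H≡) (+n+1 V)))))

      rescaled : ∀ {n vS′ u₁} → n ≡ + suc V → vS′ ≡ suc w + V → u₁ ≡ h + u′ →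
        zpow t⁻¹ (n ℤ.- + 1) * mono u′ vS′ * inv (mono u₁ w) * inv (monoRatio 1 1 (h + suc h) (suc V + V))
          ≡ mono h (suc (V + (V + 0)))
      rescaled refl refl refl = scalar-≤ u′ w V h

      τ≡ : zpow t⁻¹ (N ℤ.- + 1) * mono u′ vS * inv (mono (u ∸ 1) w) * inv (monoRatio 1 1 (h + suc h) (suc V + V))
         ≡ tauCol q t l r s
      τ≡ = trans (rescaled N≡+1+V vS≡ u∸1≡)
                 (sym (trans (tauCol-≤ q t l r s r≤s)
                             (cong (λ H′ → zpow q (-[1+ 0 ] ℤ.+ + H′) * zpow t (+ (1 + 2 ℕ.* V))) (sym H≡))))

    gamma-scaling-> : ¬ r ≤ s → GammaScaling
    gamma-scaling-> r≰s = monoRatio 1 1 0 0 , γ≡ , τ≡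
      where
      s≤r′ : s ≤ r′
      s≤r′ = NP.≤-pred (NP.≰⇒> r≰s)

      V V₀ H u₀ : ℕ
      V = vs l (suc s) r
      V₀ = ℕ.pred V
      H = hs l (suc s) r′
      u₀ = ℕ.pred u

      1≤V : 1 ≤ V
      1≤V = subst (1 ≤_) (trans (cong (vs l (suc s) r′ ℕ.+_) (sym (vs-single l r)))
                                (vs-split l (suc s) r′ r (s≤s s≤r′) (NP.n≤1+n r′)))
                  (NP.≤-trans (vv-positive l r p (s≤s z≤n) r≤d) (NP.m≤n+m _ _))

      V≡ : suc V₀ ≡ V
      V≡ = NP.suc-pred V {{ℕ.>-nonZero 1≤V}}

      w≡ : w ≡ vS + V₀
      w≡ = cong ℕ.pred (trans (sym (vs-split l 1 s r (s≤s z≤n) (NP.m≤n⇒m≤1+n s≤r′)))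
                              (trans (cong (vS ℕ.+_) (sym V≡)) (NP.+-suc vS V₀)))

      u≡ : suc u₀ ≡ u
      u≡ = NP.suc-pred u {{ℕ.>-nonZero (NP.≤-<-trans z≤n (at-suc<at (us l) (us-StrictlyDecreasing l p) r (s≤s z≤n) r≤d))}}

      u′≡ : u′ ≡ H + suc u₀
      u′≡ = trans (sym (hs-telescope l p (suc s) r′ (s≤s z≤n) (s≤s s≤r′))) (cong (H ℕ.+_) (sym u≡))

      N≡-V₀ : N ≡ ℤ.- (+ V₀)
      N≡-V₀ = trans N≡ (trans (cong (λ n → + vS ℤ.- + n) w≡) (m-[m+n] vS V₀))

      M≡-1-H : M ≡ ℤ.- (+ suc H)
      M≡-1-H = trans M≡ (trans (cong₂ (λ a b → + (a ∸ 1) ℤ.- + b) (sym u≡) u′≡) (m-[n+1+m] u₀ H))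

      γ≡ : gammaNLM q⁻¹ t⁻¹ ν l μ ≡ monoRatio 1 1 0 0 * gammaP q t l r s
      γ≡ = trans (gammaNLM-inv-> ν l μ H V₀ M≡-1-H N≡-V₀)
                 (cong (monoRatio 1 1 0 0 *_) (sym (trans (gammaP-> q t l r s r≰s)
                   (cong₂ (λ V′ H′ → (br q t (+ H) (+ V′) * br q t H′ (+ V′ ℤ.- + 1)) ÷' (br q t (+ 0) (+ 1) * br q t (+ 1) (+ 0)))
                          (sym V≡) (+n+1 H)))))

      rescaled : ∀ {n vS′ u₁ w′} → n ≡ ℤ.- (+ V₀) → vS′ ≡ H + suc u₀ → u₁ ≡ u₀ → w′ ≡ vS + V₀ →
        zpow t⁻¹ (n ℤ.- + 1) * mono vS′ vS * inv (mono u₁ w′) * inv (monoRatio 1 1 0 0) ≡ pow q H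
      rescaled refl refl refl refl = trans
        (cong (λ z → z * mono (H + suc u₀) vS * inv (mono u₀ (vS + V₀)) * inv (monoRatio 1 1 0 0))
              (trans (cong (zpow t⁻¹) (-n-1 V₀)) (zpow-inv-neg t (+ suc V₀))))
        (scalar-> H u₀ vS V₀)

      τ≡ : zpow t⁻¹ (N ℤ.- + 1) * mono u′ vS * inv (mono (u ∸ 1) w) * inv (monoRatio 1 1 0 0) ≡ tauCol q t l r s
      τ≡ = trans (rescaled N≡-V₀ u′≡ (cong (_∸ 1) (sym u≡)) w≡) (sym (tauCol-> q t l r s r≰s))

    gamma-scaling : GammaScaling
    gamma-scaling = by-cases (r ℕ.≤? s)
      where
      by-cases : Dec (r ≤ s) → GammaScaling
      by-cases (yes r≤s) = gamma-scaling-≤ r≤s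
      by-cases (no  r≰s) = gamma-scaling-> r≰s

    column-formula-suc : ∀ α′ α A′ A → α′ ≡ mono u′ vS * α → A′ ≡ mono (u ∸ 1) w * A →
      zpow t⁻¹ (N ℤ.- + 1) * α′ * (inv A′ ÷' gammaNLM q⁻¹ t⁻¹ ν l μ) ≡ tauCol q t l r s * ((α * inv A) ÷' gammaP q t l r s)
    column-formula-suc α′ α A′ A refl refl with gamma-scaling
    ... | c , γ≡ , τ≡ = begin
      d * (mono u′ vS * α) * (inv (mono (u ∸ 1) w * A) ÷' gammaNLM q⁻¹ t⁻¹ ν l μ)
        ≡⟨ cong (λ g → d * (mono u′ vS * α) * (inv (mono (u ∸ 1) w * A) ÷' g)) γ≡ ⟩
      d * (mono u′ vS * α) * (inv (mono (u ∸ 1) w * A) ÷' (c * gammaP q t l r s))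
        ≡⟨ ÷'-rescale d (mono u′ vS) (mono (u ∸ 1) w) c α A (gammaP q t l r s) ⟩
      (d * mono u′ vS * inv (mono (u ∸ 1) w) * inv c) * ((α * inv A) ÷' gammaP q t l r s)
        ≡⟨ cong (_* ((α * inv A) ÷' gammaP q t l r s)) τ≡ ⟩
      tauCol q t l r s * ((α * inv A) ÷' gammaP q t l r s) ∎
      where open ≡-Reasoning
            d = zpow t⁻¹ (N ℤ.- + 1)

lemma5p1 : (l : List ℕ) → IsPartition l →
    (q t : ℚ) → Generic q t →
    (r s : ℕ) → r ≤ dd l → s ≤ dd l →
    (pCol q t l r s ≡ pColRHS q t l r s) × (pBarCol q t l r s ≡ pBarColRHS q t l r s)
lemma5p1 l isP q t (q≢0 , t≢0 , _) zero s _ s≤d =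
  column-formula-0 _ _ alphaS-inv , column-formula-0 _ _ alphaBarS-inv
  where open ColumnFormulas l (IsPartition⇒Partition l isP) q t q≢0 t≢0 s s≤d
lemma5p1 l isP q t (q≢0 , t≢0 , _) (suc r′) s r≤d s≤d =
  column-formula-suc _ _ _ _ alphaS-inv alphaAdd-μ-inv , column-formula-suc _ _ _ _ alphaBarS-inv alphaBarAdd-μ-inv
  where open ColumnFormulas l (IsPartition⇒Partition l isP) q t q≢0 t≢0 s s≤d
        open Removal r′ r≤d
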